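{- Let $g \colon \mathrm{Comp}_{>0} \to \mathbbm{k}$ be the map such that $M_\alpha = \sum_{\beta \ge \alpha} g(\alpha, \beta) X_\beta$, where $X_\alpha = \sum_{\beta \ge \alpha} f(\alpha, \beta) M_\beta$ with \[ f(\alpha) = \begin{cases} f_\mathbb{E}(\alpha|_\mathbb{E}) \frac{1}{\mathrm{odd}(\alpha)!} & \text{if } \alpha = \alpha|_\mathbb{E} \, \alpha|_\mathbb{O}, \\ 0 & \text{otherwise.} \end{cases} \] For $|\alpha|$ odd, \[ g(\alpha) = \begin{cases} \displaystyle\frac{(-1)^{\ell(\alpha)-1}}{\mathrm{odd}(\alpha)} & \text{if the last part of } \alpha \text{ is odd}, \\ 0 & \text{otherwise.} \end{cases} \]
   Context: Work over a field $\mathbbm{k}$ of characteristic zero. Compositions are finite sequences of positive integers; $\mathrm{Comp}_{>0}$ denotes nonempty ones; $\mathrm{odd}(\alpha)$ is the number of odd parts of $\alpha$; $|\alpha|$ its sum and $\ell(\alpha)$ its length. $\mathbb{E}=\{2,4,6,\dots\}$, $\mathbb{O}=\{1,3,5,\dots\}$, and $\alpha|_C$ is the subsequence of parts of $\alpha$ in $C$. For $\alpha\le\beta$ (i.e. $\alpha=\alpha^{(1)}\cdots\alpha^{(\ell(\beta))}$ with $\alpha^{(i)}$ a composition of $\beta_i$) and a function $h$ on $\mathrm{Comp}_{>0}$, $h(\alpha,\beta)=\prod_i h(\alpha^{(i)})$. $\{M_\alpha\}$ is the monomial basis of $\mathrm{QSym}$. $f_\mathbb{E}$ is any nonsingular shuffle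 character: $f_\mathbb{E}(n)\ne0$ for all $n$ and, with $f_\mathbb{E}(\emptyset)=1$, $f_\mathbb{E}(\alpha)f_\mathbb{E}(\beta)=\sum_{\gamma\in\alpha \sqcup\!\sqcup \beta}f_\mathbb{E}(\gamma)$, where $\alpha \sqcup\!\sqcup \beta$ is the multiset of compositions of length $\ell(\alpha)+\ell(\beta)$ containing $\alpha,\beta$ as disjoint subsequences, with multiplicity. -}

module Defs where

open import Level using (Level; _⊔_)
open import Data.Nat as ℕ using (ℕ; zero; suc; _<_; _!)
open import Data.Bool using (Bool; true; false; not; if_then_else_)
open import Data.List using (List; []; _∷_; [_]; _++_; map; concatMap; foldr; length)
open import Data.Nat.ListAction using (sum)
open import Data.List.Properties using (≡-dec)
open import Data.List.Relation.Unary.All using (All)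
open import Data.Product using (_×_; _,_)
open import Relation.Nullary using (¬_; does)
open import Relation.Binary.PropositionalEquality using (_≡_)
open import Algebra.Bundles using (CommutativeRing)

ringFromℕ : ∀ {c ℓ} (R : CommutativeRing c ℓ) → ℕ → CommutativeRing.Carrier R
ringFromℕ R zero    = CommutativeRing.0# R
ringFromℕ R (suc n) = CommutativeRing._+_ R (CommutativeRing.1# R) (ringFromℕ R n)

record CharZeroField (c ℓ : Level) : Set (Level.suc (c ⊔ ℓ)) where
  field
    commRing : CommutativeRing c ℓ
  open CommutativeRing commRing public
  fromℕ : ℕ → Carrier
  fromℕ = ringFromℕ commRing
  field
    1≉0     : ¬ (1# ≈ 0#)
    inv     : (x : Carrier) → ¬ (x ≈ 0#) → Carrier
    inv-r   : (x : Carrier) (p : ¬ (x ≈ 0#)) → x * inv x p ≈ 1#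
    charZero : (n : ℕ) → ¬ (fromℕ (suc n) ≈ 0#)

  -- 1/n in the field (for n ≥ 1); the value at n = 0 is an irrelevant default
  recip : ℕ → Carrier
  recip zero    = 0#
  recip (suc n) = inv (fromℕ (suc n)) (charZero n)

  sign : ℕ → Carrier
  sign zero    = 1#
  sign (suc n) = - sign n

  Σ : List Carrier → Carrier
  Σ = foldr _+_ 0#

  Π : List Carrier → Carrier
  Π = foldr _*_ 1#

FCarrier : ∀ {c ℓ} → CharZeroField c ℓ → Set c
FCarrier F = CharZeroField.Carrier F

IsComp : List ℕ → Set
IsComp α = All (λ n → 0 < n) α

isEven : ℕ → Bool
isEven zero    = true
isEven (suc n) = not (isEven n)

isOdd : ℕ → Bool
isOdd n = not (isEven n)

filterᵇ : (ℕ → Bool) → List ℕ → List ℕ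
filterᵇ p []       = []
filterᵇ p (x ∷ xs) = if p x then x ∷ filterᵇ p xs else filterᵇ p xs

restrictE : List ℕ → List ℕ
restrictE = filterᵇ isEven

restrictO : List ℕ → List ℕ
restrictO = filterᵇ isOdd

oddCount : List ℕ → ℕ
oddCount α = length (restrictO α)

lastOdd : List ℕ → Bool
lastOdd []           = false
lastOdd (x ∷ [])     = isOdd x
lastOdd (x ∷ y ∷ ys) = lastOdd (y ∷ ys)

_==_ : List ℕ → List ℕ → Bool
α == β = does (≡-dec ℕ._≟_ α β)

-- Shuffles (as a list = multiset with multiplicity).

shuffles : List ℕ → List ℕ → List (List ℕ)
shuffles []       ys       = [ ys ]
shuffles (x ∷ xs) []       = [ x ∷ xs ]
shuffles (x ∷ xs) (y ∷ ys) =
  map (x ∷_) (shuffles xs (y ∷ ys)) ++ map (y ∷_) (shuffles (x ∷ xs) ys)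

module _ {c ℓ} (F : CharZeroField c ℓ) where
  open CharZeroField F

  IsShuffleCharacter : (List ℕ → Carrier) → Set ℓ
  IsShuffleCharacter fE =
    (fE [] ≈ 1#) ×
    ((α β : List ℕ) → IsComp α → IsComp β →
       fE α * fE β ≈ Σ (map fE (shuffles α β)))

  Nonsingular : (List ℕ → Carrier) → Set ℓ
  Nonsingular fE = (n : ℕ) → 0 < n → ¬ (fE [ n ] ≈ 0#)

-- Coarsenings: all ways of cutting α into consecutive nonempty blocks
-- α = α⁽¹⁾ ⋯ α⁽ᵏ⁾; the corresponding β ≥ α is (|α⁽¹⁾|, …, |α⁽ᵏ⁾|).

private
  extend : ℕ → List (List ℕ) → List (List (List ℕ))
  extend x []       = [ [ [ x ] ] ]
  extend x (b ∷ bs) = ([ x ] ∷ b ∷ bs) ∷ ((x ∷ b) ∷ bs) ∷ []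

splits : List ℕ → List (List (List ℕ))
splits []       = [ [] ]
splits (x ∷ xs) = concatMap (extend x) (splits xs)

module _ {c ℓ} (F : CharZeroField c ℓ) where
  open CharZeroField F

  expand : (List ℕ → Carrier) → List ℕ → List (List ℕ × Carrier)
  expand h α = map (λ bs → map sum bs , Π (map h bs)) (splits α)

  fFun : (List ℕ → Carrier) → List ℕ → Carrier
  fFun fE α =
    if α == (restrictE α ++ restrictO α)
    then fE (restrictE α) * recip (oddCount α !)
    else 0#

  -- coefficient of M_γ in  Σ_{β ≥ α} g(α,β) X_β,
  -- where X_β = Σ_{δ ≥ β} f(β,δ) M_δ
  coeffMX : (List ℕ → Carrier) → (List ℕ → Carrier) → List ℕ → List ℕ → Carrier
  coeffMX f g α γ =
    Σ (map (λ { (β , x) → x * Σ (map (λ { (δ , y) → if δ == γ then y else 0# })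
                                      (expand f β)) })
           (expand g α))

  -- g satisfies  M_α = Σ_{β ≥ α} g(α,β) X_β  for every α ∈ Comp_{>0}
  -- (equality in QSym, i.e. equality of all coefficients in the M-basis)
  InvertsX : (fE g : List ℕ → Carrier) → Set ℓ
  InvertsX fE g =
    (α : List ℕ) → IsComp α → ¬ (α ≡ []) →
    (γ : List ℕ) → coeffMX (fFun fE) g α γ ≈ (if α == γ then 1# else 0#)

  gFormula : List ℕ → Carrier
  gFormula α =
    if lastOdd α
    then sign (length α ℕ.∸ 1) * recip (oddCount α)
    else 0#

-- Comparing coefficients of M_(|α|) in M_α = Σ_β g(α,β) X_β gives, for the deconcatenation
-- product ⋆ on functions of compositions, A ⋆ exp(G) = [ℓ(α) ≤ 1]: here G is the series of g on
-- odd-sum compositions, A collects the even-sum blocks weighted by f_E, and the exponential comes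
-- from the factor 1/odd(α)! in f.  Splitting exp = cosh + sinh by parity and commuting cosh(G)
-- past sinh(G) gives
--   sinh(G)(a ∷ t) + [a even]·sinh(G)(t) = [a odd]·cosh(G)(t),
-- which determines g on odd-sum compositions by induction on the length.  For the claimed formula,
-- substituting its series into a power series w gives α ↦ [last part of α odd]·(−1)^(#even parts)·
-- (coefficient of x^odd(α) in w(artanh x)), so the same recursion reduces to
-- sinh(artanh x) = x·cosh(artanh x).
module Submission where

open import Defs
open import Data.Nat as ℕ using (ℕ; zero; suc; _!; _≤_; _<_; s≤s; z≤n; _∸_)
open import Data.Nat.Properties as ℕP using ()
open import Data.Nat.ListAction using (sum)
open import Data.Nat.ListAction.Properties using (sum-++)
open import Data.Bool using (Bool; true; false; not; if_then_else_)
open import Data.Bool.Properties using (not-involutive; not-injective; if-eta)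
open import Data.List using (List; []; _∷_; [_]; _++_; map; concatMap; length; concat)
open import Data.List.Properties using (length-map; ++-assoc; ++-identityʳ; length-++; ++-cancelˡ; ∷-injectiveˡ; concatMap-cong; ≡-dec)
open import Data.List.Relation.Unary.All as All using (All; []; _∷_)
open import Data.List.Relation.Unary.All.Properties using (++⁻ˡ; ++⁻ʳ; concat⁻)
open import Data.Product using (_×_; _,_; proj₁; proj₂)
open import Function using (_∘_)
open import Data.Empty using (⊥; ⊥-elim)
open import Data.Unit using (⊤; tt)
open import Relation.Nullary using (¬_)
open import Relation.Nullary.Decidable using (dec-true; dec-false)
open import Relation.Binary.PropositionalEquality as P using (_≡_; _≢_)

-- Defs keeps the step function of splits private, so splits is restated
-- here in a form whose cons case can be unfolded.
addPart : ℕ → List (List ℕ) → List (List (List ℕ))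
addPart x [] = [ [ [ x ] ] ]
addPart x (b ∷ bs) = ([ x ] ∷ b ∷ bs) ∷ ((x ∷ b) ∷ bs) ∷ []

splits′ : List ℕ → List (List (List ℕ))
splits′ [] = [ [] ]
splits′ (x ∷ xs) = concatMap (addPart x) (splits′ xs)

splits≡splits′ : ∀ w → splits w ≡ splits′ w
splits≡splits′ [] = P.refl
splits≡splits′ (x ∷ w) rewrite splits≡splits′ w =
  concatMap-cong (λ { [] → P.refl ; (b ∷ bs) → P.refl }) (splits′ w)

NonEmpty : ∀ {A : Set} → List A → Set
NonEmpty [] = ⊥
NonEmpty (_ ∷ _) = ⊤

IsSplit : List ℕ → List (List ℕ) → Set
IsSplit w bs = (concat bs ≡ w) × All NonEmpty bs

splits′-IsSplit : ∀ w → All (IsSplit w) (splits′ w)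
splits′-IsSplit [] = (P.refl , []) ∷ []
splits′-IsSplit (x ∷ t) = go (splits′ t) (splits′-IsSplit t)
  where
  go : ∀ L → All (IsSplit t) L → All (IsSplit (x ∷ t)) (concatMap (addPart x) L)
  go [] [] = []
  go ([] ∷ L) ((e , _) ∷ rest) = (P.cong (x ∷_) e , tt ∷ []) ∷ go L rest
  go ((b ∷ bs) ∷ L) ((e , ne ∷ nes) ∷ rest) =
    (P.cong (x ∷_) e , tt ∷ ne ∷ nes) ∷ (P.cong (x ∷_) e , tt ∷ nes) ∷ go L rest

length-suffix≤ : ∀ {A : Set} (u v t : List A) → u ++ v ≡ t → length v ≤ length t
length-suffix≤ u v _ P.refl rewrite length-++ u {v} = ℕP.m≤n+m (length v) (length u)

hasTwoBlocks : List (List ℕ) → Bool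
hasTwoBlocks (_ ∷ _ ∷ _) = true
hasTwoBlocks _ = false

length-block≤ : ∀ (bs : List (List ℕ)) → All (λ b → length b ≤ length (concat bs)) bs
length-block≤ [] = []
length-block≤ (b ∷ bs) rewrite length-++ b {concat bs} =
  ℕP.m≤m+n _ _ ∷ All.map (λ le → ℕP.≤-trans le (ℕP.m≤n+m _ _)) (length-block≤ bs)

length-block< : ∀ b b′ r → All NonEmpty (b ∷ b′ ∷ r) →
  All (λ x → length x < length (concat (b ∷ b′ ∷ r))) (b ∷ b′ ∷ r)
length-block< [] _ _ (() ∷ _)
length-block< _ [] _ (_ ∷ () ∷ _)
length-block< b@(_ ∷ _) b′@(_ ∷ _) r _ rewrite length-++ b {concat (b′ ∷ r)} =
  ℕP.m<m+n (length b) (ℕP.<-≤-trans (s≤s z≤n) (All.head (length-block≤ (b′ ∷ r))))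
  ∷ All.map (λ le → ℕP.≤-<-trans le (ℕP.m<n+m _ (s≤s z≤n))) (length-block≤ (b′ ∷ r))

#blocks≤length : ∀ (bs : List (List ℕ)) → All NonEmpty bs → length bs ≤ length (concat bs)
#blocks≤length [] _ = z≤n
#blocks≤length ((x ∷ b) ∷ bs) (_ ∷ nes) rewrite length-++ b {concat bs} =
  s≤s (ℕP.≤-trans (#blocks≤length bs nes) (ℕP.m≤n+m _ (length b)))

isEven-+ : ∀ m n → isEven (m ℕ.+ n) ≡ (if isEven m then isEven n else not (isEven n))
isEven-+ zero n = P.refl
isEven-+ (suc m) n rewrite isEven-+ m n with isEven m
... | true = P.refl
... | false = not-involutive (isEven n)

isEven-+2 : ∀ n → isEven (suc (suc n)) ≡ isEven n
isEven-+2 n = not-involutive (isEven n)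

odd⇒1≤ : ∀ n → isEven n ≡ false → 1 ≤ n
odd⇒1≤ zero ()
odd⇒1≤ (suc n) _ = s≤s z≤n

isEven-sum-++ : ∀ u v w → u ++ v ≡ w →
  isEven (sum w) ≡ (if isEven (sum u) then isEven (sum v) else not (isEven (sum v)))
isEven-sum-++ u v w e = P.trans (P.cong isEven (P.trans (P.cong sum (P.sym e)) (sum-++ u v))) (isEven-+ (sum u) (sum v))

allOdd : List ℕ → Bool
allOdd [] = true
allOdd (x ∷ l) = if isEven x then false else allOdd l

allEven : List ℕ → Bool
allEven [] = true
allEven (x ∷ l) = if isEven x then allEven l else false

sum-concat : ∀ bs → sum (concat bs) ≡ sum (map sum bs)
sum-concat [] = P.refl
sum-concat (b ∷ bs) = P.trans (sum-++ b (concat bs)) (P.cong (sum b ℕ.+_) (sum-concat bs))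

allOdd⇒isEven-sum≡isEven-length : ∀ l → allOdd l ≡ true → isEven (sum l) ≡ isEven (length l)
allOdd⇒isEven-sum≡isEven-length [] _ = P.refl
allOdd⇒isEven-sum≡isEven-length (x ∷ l) e with isEven x in ex
allOdd⇒isEven-sum≡isEven-length (x ∷ l) () | true
... | false rewrite isEven-+ x (sum l) | ex | allOdd⇒isEven-sum≡isEven-length l e = P.refl

allEven⇒isEven-sum : ∀ l → allEven l ≡ true → isEven (sum l) ≡ true
allEven⇒isEven-sum [] _ = P.refl
allEven⇒isEven-sum (x ∷ l) e with isEven x in ex
allEven⇒isEven-sum (x ∷ l) () | false
... | true rewrite isEven-+ x (sum l) | ex = allEven⇒isEven-sum l e

allEven-∷ʳ : ∀ π s → allEven π ≡ true → isEven s ≡ true → allEven (π ++ [ s ]) ≡ true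
allEven-∷ʳ [] s _ es rewrite es = P.refl
allEven-∷ʳ (x ∷ π) s e es with isEven x
allEven-∷ʳ (x ∷ π) s () es | false
... | true = allEven-∷ʳ π s e es

evenCount : List ℕ → ℕ
evenCount w = length (restrictE w)

isEven-sum≡isEven-oddCount : ∀ w → isEven (sum w) ≡ isEven (oddCount w)
isEven-sum≡isEven-oddCount [] = P.refl
isEven-sum≡isEven-oddCount (x ∷ w)
  rewrite isEven-+ x (sum w) | isEven-sum≡isEven-oddCount w with isEven x
... | true = P.refl
... | false = P.refl

length≡evenCount+oddCount : ∀ w → length w ≡ evenCount w ℕ.+ oddCount w
length≡evenCount+oddCount [] = P.refl
length≡evenCount+oddCount (x ∷ w) with isEven x
... | true = P.cong suc (length≡evenCount+oddCount w)
... | false = P.trans (P.cong suc (length≡evenCount+oddCount w)) (P.sym (ℕP.+-suc _ _))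

oddCount≤length : ∀ w → oddCount w ≤ length w
oddCount≤length w = P.subst (oddCount w ≤_) (P.sym (length≡evenCount+oddCount w)) (ℕP.m≤n+m _ _)

emptyOrLastOdd : List ℕ → Bool
emptyOrLastOdd [] = true
emptyOrLastOdd (x ∷ []) = isOdd x
emptyOrLastOdd (x ∷ y ∷ l) = emptyOrLastOdd (y ∷ l)

emptyOrLastOdd-∷ : ∀ x t → emptyOrLastOdd (x ∷ t) ≡ lastOdd (x ∷ t)
emptyOrLastOdd-∷ x [] = P.refl
emptyOrLastOdd-∷ x (y ∷ t) = emptyOrLastOdd-∷ y t

emptyOrLastOdd⇒1≤oddCount : ∀ x t → emptyOrLastOdd (x ∷ t) ≡ true → 1 ≤ oddCount (x ∷ t)
emptyOrLastOdd⇒1≤oddCount x [] e with isEven x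
emptyOrLastOdd⇒1≤oddCount x [] () | true
... | false = s≤s z≤n
emptyOrLastOdd⇒1≤oddCount x (y ∷ t) e with isEven x
... | true = emptyOrLastOdd⇒1≤oddCount y t e
... | false = s≤s z≤n

restrictE-allEven-++ : ∀ π l → allEven π ≡ true → restrictE (π ++ l) ≡ π ++ restrictE l
restrictE-allEven-++ [] l _ = P.refl
restrictE-allEven-++ (x ∷ π) l e with isEven x
restrictE-allEven-++ (x ∷ π) l () | false
... | true = P.cong (x ∷_) (restrictE-allEven-++ π l e)

restrictO-allEven-++ : ∀ π l → allEven π ≡ true → restrictO (π ++ l) ≡ restrictO l
restrictO-allEven-++ [] l _ = P.refl
restrictO-allEven-++ (x ∷ π) l e with isEven x
restrictO-allEven-++ (x ∷ π) l () | false
... | true = restrictO-allEven-++ π l e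

restrictE-allEven : ∀ π → allEven π ≡ true → restrictE π ≡ π
restrictE-allEven π e =
  P.trans (P.cong restrictE (P.sym (++-identityʳ π))) (P.trans (restrictE-allEven-++ π [] e) (++-identityʳ π))

restrictO-allEven : ∀ π → allEven π ≡ true → restrictO π ≡ []
restrictO-allEven π e = P.trans (P.cong restrictO (P.sym (++-identityʳ π))) (restrictO-allEven-++ π [] e)

restrictE-allOdd : ∀ β → allOdd β ≡ true → restrictE β ≡ []
restrictE-allOdd [] _ = P.refl
restrictE-allOdd (x ∷ β) e with isEven x
restrictE-allOdd (x ∷ β) () | true
... | false = restrictE-allOdd β e

restrictO-allOdd : ∀ β → allOdd β ≡ true → restrictO β ≡ β
restrictO-allOdd [] _ = P.refl
restrictO-allOdd (x ∷ β) e with isEven x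
restrictO-allOdd (x ∷ β) () | true
... | false = P.cong (x ∷_) (restrictO-allOdd β e)

restrictE≡[]⇒allOdd : ∀ β → restrictE β ≡ [] → allOdd β ≡ true
restrictE≡[]⇒allOdd [] _ = P.refl
restrictE≡[]⇒allOdd (x ∷ β) e with isEven x
restrictE≡[]⇒allOdd (x ∷ β) () | true
... | false = restrictE≡[]⇒allOdd β e

restrictE-head-even : ∀ β e r → restrictE β ≡ e ∷ r → isEven e ≡ true
restrictE-head-even [] e r ()
restrictE-head-even (x ∷ β) e r eq with isEven x in ex
... | true = P.subst (λ y → isEven y ≡ true) (∷-injectiveˡ eq) ex
... | false = restrictE-head-even β e r eq

==-true : ∀ {a b : List ℕ} → a ≡ b → (a == b) ≡ true
==-true {a} {b} = dec-true (≡-dec ℕ._≟_ a b)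

==-false : ∀ {a b : List ℕ} → a ≢ b → (a == b) ≡ false
==-false {a} {b} = dec-false (≡-dec ℕ._≟_ a b)

module _ {c ℓ} (F : CharZeroField c ℓ) where
  open CharZeroField F
  open import Relation.Binary.Reasoning.Setoid setoid
  open import Algebra.Properties.Ring ring using (-‿involutive; -‿distribˡ-*; -‿distribʳ-*; -0#≈0#; -1*x≈-x; +-cancelʳ)
  open import Algebra.Properties.CommutativeSemigroup +-commutativeSemigroup using () renaming (interchange to +-interchange)
  open import Algebra.Properties.CommutativeSemigroup *-commutativeSemigroup using () renaming (x∙yz≈y∙xz to x*yz≈y*xz)

  C : Set c
  C = Carrier

  [1+x]*y≈y+x*y : ∀ x y → (1# + x) * y ≈ y + x * y
  [1+x]*y≈y+x*y x y = trans (distribʳ y 1# x) (+-congʳ (*-identityˡ y))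

  -x+[y+x]≈y : ∀ x y → - x + (y + x) ≈ y
  -x+[y+x]≈y x y = trans (+-congˡ (+-comm y x)) (trans (sym (+-assoc _ _ _)) (trans (+-congʳ (-‿inverseˡ x)) (+-identityˡ y)))

  module _ {A : Set} where
    sumOver : (A → C) → List A → C
    sumOver h l = Σ (map h l)

    sumOver-++ : ∀ (h : A → C) l1 l2 → sumOver h (l1 ++ l2) ≈ sumOver h l1 + sumOver h l2
    sumOver-++ h [] l2 = sym (+-identityˡ _)
    sumOver-++ h (a ∷ l1) l2 = trans (+-congˡ (sumOver-++ h l1 l2)) (sym (+-assoc _ _ _))

    sumOver-+ : ∀ (h1 h2 : A → C) l → sumOver (λ a → h1 a + h2 a) l ≈ sumOver h1 l + sumOver h2 l
    sumOver-+ h1 h2 [] = sym (+-identityˡ _)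
    sumOver-+ h1 h2 (a ∷ l) = trans (+-congˡ (sumOver-+ h1 h2 l))
      (+-interchange (h1 a) (h2 a) (sumOver h1 l) (sumOver h2 l))

    sumOver-* : ∀ k (h : A → C) l → sumOver (λ a → k * h a) l ≈ k * sumOver h l
    sumOver-* k h [] = sym (zeroʳ k)
    sumOver-* k h (a ∷ l) = trans (+-congˡ (sumOver-* k h l)) (sym (distribˡ k _ _))

    sumOver-cong : ∀ {h1 h2 : A → C} l → All (λ a → h1 a ≈ h2 a) l → sumOver h1 l ≈ sumOver h2 l
    sumOver-cong [] [] = refl
    sumOver-cong (a ∷ l) (p ∷ ps) = +-cong p (sumOver-cong l ps)

    sumOver-zero : ∀ {h : A → C} l → All (λ a → h a ≈ 0#) l → sumOver h l ≈ 0#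
    sumOver-zero [] [] = refl
    sumOver-zero (a ∷ l) (p ∷ ps) = trans (+-cong p (sumOver-zero l ps)) (+-identityˡ 0#)

  sumOver-map-map : ∀ {b} {A : Set} {B : Set b} (φ : B → C) (ψ : A → B) (χ : A → C) →
    (∀ a → φ (ψ a) ≡ χ a) → ∀ l → Σ (map φ (map ψ l)) ≡ sumOver χ l
  sumOver-map-map φ ψ χ h [] = P.refl
  sumOver-map-map φ ψ χ h (a ∷ l) = P.cong₂ _+_ (h a) (sumOver-map-map φ ψ χ h l)

  sumOver-concatMap : ∀ {A B : Set} (h : B → C) (f : A → List B) l →
    sumOver h (concatMap f l) ≈ sumOver (λ a → sumOver h (f a)) l
  sumOver-concatMap h f [] = refl
  sumOver-concatMap h f (a ∷ l) = trans (sumOver-++ h (f a) (concatMap f l)) (+-congˡ (sumOver-concatMap h f l))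

  -- Deconcatenation: Δ K t sums K u v over all ways of writing t = u ++ v.
  module _ {A : Set} where
    Δ : (List A → List A → C) → List A → C
    Δ K [] = K [] []
    Δ K (x ∷ l) = K [] (x ∷ l) + Δ (λ u v → K (x ∷ u) v) l

    Δ-cong : ∀ {K K′ : List A → List A → C} t → (∀ u v → u ++ v ≡ t → K u v ≈ K′ u v) → Δ K t ≈ Δ K′ t
    Δ-cong [] h = h [] [] P.refl
    Δ-cong (x ∷ l) h = +-cong (h [] (x ∷ l) P.refl) (Δ-cong l (λ u v e → h (x ∷ u) v (P.cong (x ∷_) e)))

    Δ-cong′ : ∀ {K K′ : List A → List A → C} t → (∀ u v → K u v ≈ K′ u v) → Δ K t ≈ Δ K′ t
    Δ-cong′ t h = Δ-cong t (λ u v _ → h u v)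

    Δ-+ : ∀ (K K′ : List A → List A → C) t → Δ (λ u v → K u v + K′ u v) t ≈ Δ K t + Δ K′ t
    Δ-+ K K′ [] = refl
    Δ-+ K K′ (x ∷ l) = trans (+-congˡ (Δ-+ (λ u v → K (x ∷ u) v) (λ u v → K′ (x ∷ u) v) l))
      (+-interchange _ _ _ _)

    Δ-*ˡ : ∀ k (K : List A → List A → C) t → Δ (λ u v → k * K u v) t ≈ k * Δ K t
    Δ-*ˡ k K [] = refl
    Δ-*ˡ k K (x ∷ l) = trans (+-congˡ (Δ-*ˡ k (λ u v → K (x ∷ u) v) l)) (sym (distribˡ k _ _))

    Δ-*ʳ : ∀ k (K : List A → List A → C) t → Δ (λ u v → K u v * k) t ≈ Δ K t * k
    Δ-*ʳ k K [] = refl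
    Δ-*ʳ k K (x ∷ l) = trans (+-congˡ (Δ-*ʳ k (λ u v → K (x ∷ u) v) l)) (sym (distribʳ k _ _))

    Δ-zero : ∀ {K : List A → List A → C} t → (∀ u v → u ++ v ≡ t → K u v ≈ 0#) → Δ K t ≈ 0#
    Δ-zero [] h = h [] [] P.refl
    Δ-zero (x ∷ l) h = trans (+-cong (h [] (x ∷ l) P.refl) (Δ-zero l (λ u v e → h (x ∷ u) v (P.cong (x ∷_) e)))) (+-identityˡ 0#)

    Δ-head : ∀ {K : List A → List A → C} t → (∀ x u v → K (x ∷ u) v ≈ 0#) → Δ K t ≈ K [] t
    Δ-head [] h = refl
    Δ-head (x ∷ l) h = trans (+-congˡ (Δ-zero l (λ u v _ → h x u v))) (+-identityʳ _)

    Δ-last : ∀ {K : List A → List A → C} t → (∀ u v → u ++ v ≡ t → NonEmpty v → K u v ≈ 0#) → Δ K t ≈ K t []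
    Δ-last [] h = refl
    Δ-last (x ∷ l) h =
      trans (+-cong (h [] (x ∷ l) P.refl tt) (Δ-last l (λ u v e ne → h (x ∷ u) v (P.cong (x ∷_) e) ne))) (+-identityˡ _)

    Δ-assoc : ∀ (K : List A → List A → List A → C) t →
      Δ (λ u v → Δ (λ u1 v1 → K u1 v1 v) u) t ≈ Δ (λ u1 w → Δ (λ v1 v → K u1 v1 v) w) t
    Δ-assoc K [] = refl
    Δ-assoc K (x ∷ l) = begin
        K [] [] (x ∷ l) + Δ (λ u v → K [] (x ∷ u) v + Δ (λ u1 v1 → K (x ∷ u1) v1 v) u) l
        ≈⟨ +-congˡ (Δ-+ (λ u v → K [] (x ∷ u) v) (λ u v → Δ (λ u1 v1 → K (x ∷ u1) v1 v) u) l) ⟩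
        K [] [] (x ∷ l) + (Δ (λ u v → K [] (x ∷ u) v) l + Δ (λ u v → Δ (λ u1 v1 → K (x ∷ u1) v1 v) u) l)
        ≈⟨ +-congˡ (+-congˡ (Δ-assoc (λ u1 v1 v → K (x ∷ u1) v1 v) l)) ⟩
        K [] [] (x ∷ l) + (Δ (λ u v → K [] (x ∷ u) v) l + Δ (λ u1 w → Δ (λ v1 v → K (x ∷ u1) v1 v) w) l)
        ≈⟨ sym (+-assoc _ _ _) ⟩
        (K [] [] (x ∷ l) + Δ (λ u v → K [] (x ∷ u) v) l) + Δ (λ u1 w → Δ (λ v1 v → K (x ∷ u1) v1 v) w) l
      ∎

    infixl 7 _⋆_
    _⋆_ : (List A → C) → (List A → C) → List A → C
    p ⋆ q = Δ (λ u v → p u * q v)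

    ⋆-assoc : ∀ (p q r : List A → C) t → ((p ⋆ q) ⋆ r) t ≈ (p ⋆ (q ⋆ r)) t
    ⋆-assoc p q r t = begin
        Δ (λ u v → Δ (λ u1 v1 → p u1 * q v1) u * r v) t
        ≈⟨ Δ-cong′ t (λ u v → sym (Δ-*ʳ (r v) (λ u1 v1 → p u1 * q v1) u)) ⟩
        Δ (λ u v → Δ (λ u1 v1 → (p u1 * q v1) * r v) u) t
        ≈⟨ Δ-assoc (λ u1 v1 v → (p u1 * q v1) * r v) t ⟩
        Δ (λ u1 w → Δ (λ v1 v → (p u1 * q v1) * r v) w) t
        ≈⟨ Δ-cong′ t (λ u1 w → trans (Δ-cong′ w (λ v1 v → *-assoc _ _ _)) (Δ-*ˡ (p u1) (λ v1 v → q v1 * r v) w)) ⟩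
        Δ (λ u1 w → p u1 * Δ (λ v1 v → q v1 * r v) w) t
      ∎

    ⋆-cong : ∀ {p p′ q q′ : List A → C} t → (∀ u v → u ++ v ≡ t → p u ≈ p′ u) →
      (∀ u v → u ++ v ≡ t → q v ≈ q′ v) → (p ⋆ q) t ≈ (p′ ⋆ q′) t
    ⋆-cong t hp hq = Δ-cong t (λ u v e → *-cong (hp u v e) (hq u v e))

    δ[] : List A → C
    δ[] [] = 1#
    δ[] (_ ∷ _) = 0#

    ⋆-identityˡ : ∀ (q : List A → C) t → (δ[] ⋆ q) t ≈ q t
    ⋆-identityˡ q t = trans (Δ-head t (λ x u v → zeroˡ _)) (*-identityˡ _)

    ⋆-distribˡ-+ : ∀ (p q q′ : List A → C) t → (p ⋆ (λ v → q v + q′ v)) t ≈ (p ⋆ q) t + (p ⋆ q′) t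
    ⋆-distribˡ-+ p q q′ t = trans (Δ-cong′ t (λ u v → distribˡ _ _ _)) (Δ-+ _ _ t)

    ⋆-distribʳ-+ : ∀ (p p′ q : List A → C) t → ((λ u → p u + p′ u) ⋆ q) t ≈ (p ⋆ q) t + (p′ ⋆ q) t
    ⋆-distribʳ-+ p p′ q t = trans (Δ-cong′ t (λ u v → distribʳ _ _ _)) (Δ-+ _ _ t)

    ⋆-*ˡ : ∀ k (p q : List A → C) t → ((λ u → k * p u) ⋆ q) t ≈ k * (p ⋆ q) t
    ⋆-*ˡ k p q t = trans (Δ-cong′ t (λ u v → *-assoc _ _ _)) (Δ-*ˡ k _ t)

    ⋆-negˡ : ∀ (p q : List A → C) t → ((λ u → - p u) ⋆ q) t ≈ - (p ⋆ q) t
    ⋆-negˡ p q t = trans (Δ-cong′ t (λ u v → *-congʳ (sym (-1*x≈-x _)))) (trans (⋆-*ˡ (- 1#) p q t) (-1*x≈-x _))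

  Σsplits : (List (List ℕ) → C) → List ℕ → C
  Σsplits h w = sumOver h (splits′ w)

  Σsplits-cong : ∀ {h h′ : List (List ℕ) → C} w → (∀ bs → IsSplit w bs → h bs ≈ h′ bs) → Σsplits h w ≈ Σsplits h′ w
  Σsplits-cong w h≈h′ = sumOver-cong (splits′ w) (All.map (h≈h′ _) (splits′-IsSplit w))

  Σsplits-cong′ : ∀ {h h′ : List (List ℕ) → C} w → (∀ bs → h bs ≈ h′ bs) → Σsplits h w ≈ Σsplits h′ w
  Σsplits-cong′ w h≈h′ = Σsplits-cong w (λ bs _ → h≈h′ bs)

  Σsplits-+ : ∀ (h h′ : List (List ℕ) → C) w → Σsplits (λ bs → h bs + h′ bs) w ≈ Σsplits h w + Σsplits h′ w
  Σsplits-+ h h′ w = sumOver-+ h h′ (splits′ w)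

  Σsplits-* : ∀ k (h : List (List ℕ) → C) w → Σsplits (λ bs → k * h bs) w ≈ k * Σsplits h w
  Σsplits-* k h w = sumOver-* k h (splits′ w)

  Σsplits-zero : ∀ {h : List (List ℕ) → C} w → (∀ bs → IsSplit w bs → h bs ≈ 0#) → Σsplits h w ≈ 0#
  Σsplits-zero w h≈0 = sumOver-zero (splits′ w) (All.map (h≈0 _) (splits′-IsSplit w))

  Σsplits-[] : ∀ (h : List (List ℕ) → C) → Σsplits h [] ≈ h []
  Σsplits-[] h = +-identityʳ _

  onFirstBlock : ℕ → (List (List ℕ) → C) → List (List ℕ) → C
  onFirstBlock x h [] = 0#
  onFirstBlock x h (b ∷ r) = h ((x ∷ b) ∷ r)

  Σsplits-∷ : ∀ (h : List (List ℕ) → C) x t →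
    Σsplits h (x ∷ t) ≈ Σsplits (λ bs → h ([ x ] ∷ bs)) t + Σsplits (onFirstBlock x h) t
  Σsplits-∷ h x t = begin
      sumOver h (concatMap (addPart x) (splits′ t))
      ≈⟨ sumOver-concatMap h (addPart x) (splits′ t) ⟩
      sumOver (λ bs → sumOver h (addPart x bs)) (splits′ t)
      ≈⟨ sumOver-cong (splits′ t) (All.tabulate (λ {bs} _ → el bs)) ⟩
      sumOver (λ bs → h ([ x ] ∷ bs) + onFirstBlock x h bs) (splits′ t)
      ≈⟨ sumOver-+ (λ bs → h ([ x ] ∷ bs)) (onFirstBlock x h) (splits′ t) ⟩
      Σsplits (λ bs → h ([ x ] ∷ bs)) t + Σsplits (onFirstBlock x h) t
    ∎
    where
    el : ∀ bs → sumOver h (addPart x bs) ≈ h ([ x ] ∷ bs) + onFirstBlock x h bs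
    el [] = refl
    el (b ∷ r) = +-congˡ (+-identityʳ _)

  Σsplits-firstBlock : ∀ (h : List (List ℕ) → C) x t →
    Σsplits h (x ∷ t) ≈ Δ (λ u v → Σsplits (λ bs → h ((x ∷ u) ∷ bs)) v) t
  Σsplits-firstBlock h x [] = trans (Σsplits-∷ h x []) (trans (+-congˡ (+-identityˡ 0#)) (+-identityʳ _))
  Σsplits-firstBlock h x (y ∷ t) = trans (Σsplits-∷ h x (y ∷ t)) (+-congˡ (Σsplits-firstBlock (onFirstBlock x h) y t))

  Σsplits-singleBlock : ∀ (h : List (List ℕ) → C) x t →
    (∀ b b′ r → IsSplit (x ∷ t) (b ∷ b′ ∷ r) → h (b ∷ b′ ∷ r) ≈ 0#) → Σsplits h (x ∷ t) ≈ h [ x ∷ t ]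
  Σsplits-singleBlock h x t vanish =
    trans (Σsplits-firstBlock h x t) (trans (Δ-last t restVanishes) (Σsplits-[] (λ bs → h ((x ∷ t) ∷ bs))))
    where
    restVanishes : ∀ u v → u ++ v ≡ t → NonEmpty v → Σsplits (λ bs → h ((x ∷ u) ∷ bs)) v ≈ 0#
    restVanishes u v e ne = Σsplits-zero v blocks
      where
      blocks : ∀ bs → IsSplit v bs → h ((x ∷ u) ∷ bs) ≈ 0#
      blocks [] (e′ , _) = ⊥-elim (P.subst NonEmpty (P.sym e′) ne)
      blocks (b′ ∷ r) (e′ , nes) = vanish (x ∷ u) b′ r (P.cong (x ∷_) (P.trans (P.cong (u ++_) e′) e) , tt ∷ nes)

  -- A cut w = u ++ v together with splits of u and of v is the same as a split of w
  -- together with a cut of its list of blocks.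
  ⋆-Σsplits : ∀ (h₁ h₂ : List (List ℕ) → C) w →
    (Σsplits h₁ ⋆ Σsplits h₂) w ≈ Σsplits (Δ (λ b₁ b₂ → h₁ b₁ * h₂ b₂)) w
  ⋆-Σsplits h₁ h₂ w = go (length w) w ℕP.≤-refl h₁
    where
    go : ∀ n w → length w ≤ n → ∀ h₁ → (Σsplits h₁ ⋆ Σsplits h₂) w ≈ Σsplits (Δ (λ b₁ b₂ → h₁ b₁ * h₂ b₂)) w
    go n [] _ h₁ = trans (*-cong (+-identityʳ _) (+-identityʳ _)) (sym (+-identityʳ _))
    go (suc n) (x ∷ t) (s≤s le) h₁ = begin
      Σsplits h₁ [] * Σsplits h₂ (x ∷ t) + Δ (λ u v → Σsplits h₁ (x ∷ u) * Σsplits h₂ v) t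
        ≈⟨ +-cong (*-cong (Σsplits-[] h₁) (Σsplits-firstBlock h₂ x t))
                  (Δ-cong′ t (λ u v → *-congʳ (Σsplits-firstBlock h₁ x u))) ⟩
      h₁ [] * Δ (λ u v → Σsplits (H₂ u) v) t + Δ (λ u v → Δ (λ u₁ v₁ → Σsplits (H₁ u₁) v₁) u * Σsplits h₂ v) t
        ≈⟨ +-cong (Δ-*ˡ _ _ t) (Δ-cong′ t (λ u v → Δ-*ʳ _ _ u)) ⟨
      Δ (λ u v → h₁ [] * Σsplits (H₂ u) v) t + Δ (λ u v → Δ (λ u₁ v₁ → Σsplits (H₁ u₁) v₁ * Σsplits h₂ v) u) t
        ≈⟨ +-congˡ (Δ-assoc (λ u₁ v₁ v → Σsplits (H₁ u₁) v₁ * Σsplits h₂ v) t) ⟩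
      Δ (λ u v → h₁ [] * Σsplits (H₂ u) v) t + Δ (λ u w → (Σsplits (H₁ u) ⋆ Σsplits h₂) w) t
        ≈⟨ +-cong (Δ-cong′ t (λ u v → Σsplits-* _ _ v))
                  (Δ-cong t (λ u w e → sym (go n w (ℕP.≤-trans (length-suffix≤ u w t e) le) (H₁ u)))) ⟨
      Δ (λ u v → Σsplits (λ bs → h₁ [] * H₂ u bs) v) t + Δ (λ u w → Σsplits (Δ (λ b₁ b₂ → H₁ u b₁ * h₂ b₂)) w) t
        ≈⟨ Δ-+ _ _ t ⟨
      Δ (λ u v → Σsplits (λ bs → h₁ [] * H₂ u bs) v + Σsplits (Δ (λ b₁ b₂ → H₁ u b₁ * h₂ b₂)) v) t
        ≈⟨ Δ-cong′ t (λ u v → Σsplits-+ _ _ v) ⟨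
      Δ (λ u v → Σsplits (λ bs → Δ (λ b₁ b₂ → h₁ b₁ * h₂ b₂) ((x ∷ u) ∷ bs)) v) t
        ≈⟨ Σsplits-firstBlock _ x t ⟨
      Σsplits (Δ (λ b₁ b₂ → h₁ b₁ * h₂ b₂)) (x ∷ t) ∎
      where
      H₁ H₂ : List ℕ → List (List ℕ) → C
      H₁ u bs = h₁ ((x ∷ u) ∷ bs)
      H₂ u bs = h₂ ((x ∷ u) ∷ bs)

  sign-+2 : ∀ n → sign (suc (suc n)) ≈ sign n
  sign-+2 n = -‿involutive (sign n)

  sign-+-even : ∀ a b → isEven b ≡ true → sign (a ℕ.+ b) ≈ sign a
  sign-+-even (suc a) b e = -‿cong (sign-+-even a b e)
  sign-+-even zero b e = sign-even b e
    where
    sign-even : ∀ b → isEven b ≡ true → sign b ≈ 1#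
    sign-even zero _ = refl
    sign-even (suc zero) ()
    sign-even (suc (suc b)) e = trans (sign-+2 b) (sign-even b (P.trans (P.sym (isEven-+2 b)) e))

  fromℕ-+ : ∀ m n → fromℕ (m ℕ.+ n) ≈ fromℕ m + fromℕ n
  fromℕ-+ zero n = sym (+-identityˡ _)
  fromℕ-+ (suc m) n = trans (+-congˡ (fromℕ-+ m n)) (sym (+-assoc _ _ _))

  fromℕ-* : ∀ m n → fromℕ (m ℕ.* n) ≈ fromℕ m * fromℕ n
  fromℕ-* zero n = sym (zeroˡ _)
  fromℕ-* (suc m) n =
    trans (fromℕ-+ n (m ℕ.* n)) (trans (+-cong (sym (*-identityˡ _)) (fromℕ-* m n)) (sym (distribʳ _ _ _)))

  fromℕ*recip : ∀ n → 1 ≤ n → fromℕ n * recip n ≈ 1#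
  fromℕ*recip (suc n) _ = inv-r (fromℕ (suc n)) (charZero n)

  recip*fromℕ : ∀ n → 1 ≤ n → recip n * fromℕ n ≈ 1#
  recip*fromℕ n le = trans (*-comm _ _) (fromℕ*recip n le)

  fromℕ-cancelˡ : ∀ n → 1 ≤ n → ∀ {a b} → fromℕ n * a ≈ fromℕ n * b → a ≈ b
  fromℕ-cancelˡ n le {a} {b} e = begin
    a                          ≈⟨ sym (*-identityˡ a) ⟩
    1# * a                     ≈⟨ *-congʳ (sym (recip*fromℕ n le)) ⟩
    (recip n * fromℕ n) * a    ≈⟨ *-assoc _ _ _ ⟩
    recip n * (fromℕ n * a)    ≈⟨ *-congˡ e ⟩
    recip n * (fromℕ n * b)    ≈⟨ sym (*-assoc _ _ _) ⟩
    (recip n * fromℕ n) * b    ≈⟨ *-congʳ (recip*fromℕ n le) ⟩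
    1# * b                     ≈⟨ *-identityˡ b ⟩
    b                          ∎

  recip-unique : ∀ n x → 1 ≤ n → fromℕ n * x ≈ 1# → x ≈ recip n
  recip-unique n x le e = fromℕ-cancelˡ n le (trans e (sym (fromℕ*recip n le)))

  fromℕ-suc-cancelˡ : ∀ n {a b} → fromℕ (suc n) * a ≈ fromℕ (suc n) * b → a ≈ b
  fromℕ-suc-cancelˡ n = fromℕ-cancelˡ (suc n) (s≤s z≤n)

  recip1≈1 : recip 1 ≈ 1#
  recip1≈1 = sym (recip-unique 1 1# (s≤s z≤n) (trans (*-identityʳ _) (+-identityʳ 1#)))

  fromℕ-suc*recip-! : ∀ r → fromℕ (suc r) * recip (suc r !) ≈ recip (r !)
  fromℕ-suc*recip-! r = recip-unique (r !) _ (ℕP.1≤n! r) (begin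
      fromℕ (r !) * (fromℕ (suc r) * recip (suc r !)) ≈⟨ sym (*-assoc _ _ _) ⟩
      (fromℕ (r !) * fromℕ (suc r)) * recip (suc r !) ≈⟨ *-congʳ (*-comm _ _) ⟩
      (fromℕ (suc r) * fromℕ (r !)) * recip (suc r !) ≈⟨ *-congʳ (sym (fromℕ-* (suc r) (r !))) ⟩
      fromℕ (suc r !) * recip (suc r !) ≈⟨ fromℕ*recip (suc r !) (ℕP.1≤n! (suc r)) ⟩
      1# ∎)

  -- Formal power series in one variable, as coefficient sequences ℕ → C: ⊛ is their
  -- product and xD a is x·a′.  Sums over powers of artanh x = Σ_{n odd} xⁿ/n are cut
  -- off at degree M, which is harmless in degrees ≤ M since artanh^ r vanishes below r.
  Δℕ : (ℕ → ℕ → C) → ℕ → C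
  Δℕ K zero = K 0 0
  Δℕ K (suc n) = K 0 (suc n) + Δℕ (λ i j → K (suc i) j) n

  Δℕ-cong : ∀ {K K′ : ℕ → ℕ → C} n → (∀ i j → K i j ≈ K′ i j) → Δℕ K n ≈ Δℕ K′ n
  Δℕ-cong zero h = h 0 0
  Δℕ-cong (suc n) h = +-cong (h 0 (suc n)) (Δℕ-cong n (λ i j → h (suc i) j))

  Δℕ-+ : ∀ (K K′ : ℕ → ℕ → C) n → Δℕ (λ u v → K u v + K′ u v) n ≈ Δℕ K n + Δℕ K′ n
  Δℕ-+ K K′ zero = refl
  Δℕ-+ K K′ (suc l) = trans (+-congˡ (Δℕ-+ (λ u v → K (suc u) v) (λ u v → K′ (suc u) v) l))
      (+-interchange _ _ _ _)

  Δℕ-*ˡ : ∀ k (K : ℕ → ℕ → C) n → Δℕ (λ u v → k * K u v) n ≈ k * Δℕ K n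
  Δℕ-*ˡ k K zero = refl
  Δℕ-*ˡ k K (suc l) = trans (+-congˡ (Δℕ-*ˡ k (λ u v → K (suc u) v) l)) (sym (distribˡ k _ _))

  Δℕ-*ʳ : ∀ k (K : ℕ → ℕ → C) n → Δℕ (λ u v → K u v * k) n ≈ Δℕ K n * k
  Δℕ-*ʳ k K zero = refl
  Δℕ-*ʳ k K (suc l) = trans (+-congˡ (Δℕ-*ʳ k (λ u v → K (suc u) v) l)) (sym (distribʳ k _ _))

  Δℕ-zero : ∀ {K : ℕ → ℕ → C} n → (∀ i j → i ℕ.+ j ≡ n → K i j ≈ 0#) → Δℕ K n ≈ 0#
  Δℕ-zero zero h = h 0 0 P.refl
  Δℕ-zero (suc n) h = trans (+-cong (h 0 (suc n) P.refl) (Δℕ-zero n (λ i j e → h (suc i) j (P.cong suc e)))) (+-identityˡ 0#)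

  Δℕ-assoc : ∀ (K : ℕ → ℕ → ℕ → C) t →
    Δℕ (λ u v → Δℕ (λ u1 v1 → K u1 v1 v) u) t ≈ Δℕ (λ u1 w → Δℕ (λ v1 v → K u1 v1 v) w) t
  Δℕ-assoc K zero = refl
  Δℕ-assoc K (suc l) = begin
      K 0 0 (suc l) + Δℕ (λ u v → K 0 (suc u) v + Δℕ (λ u1 v1 → K (suc u1) v1 v) u) l
      ≈⟨ +-congˡ (Δℕ-+ (λ u v → K 0 (suc u) v) (λ u v → Δℕ (λ u1 v1 → K (suc u1) v1 v) u) l) ⟩
      K 0 0 (suc l) + (Δℕ (λ u v → K 0 (suc u) v) l + Δℕ (λ u v → Δℕ (λ u1 v1 → K (suc u1) v1 v) u) l)
      ≈⟨ +-congˡ (+-congˡ (Δℕ-assoc (λ u1 v1 v → K (suc u1) v1 v) l)) ⟩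
      K 0 0 (suc l) + (Δℕ (λ u v → K 0 (suc u) v) l + Δℕ (λ u1 w → Δℕ (λ v1 v → K (suc u1) v1 v) w) l)
      ≈⟨ sym (+-assoc _ _ _) ⟩
      (K 0 0 (suc l) + Δℕ (λ u v → K 0 (suc u) v) l) + Δℕ (λ u1 w → Δℕ (λ v1 v → K (suc u1) v1 v) w) l
    ∎

  Δℕ-peel : ∀ (K : ℕ → ℕ → C) n → Δℕ K (suc n) ≈ Δℕ (λ i j → K i (suc j)) n + K (suc n) 0
  Δℕ-peel K zero = refl
  Δℕ-peel K (suc n) = trans (+-congˡ (Δℕ-peel (λ i j → K (suc i) j) n)) (sym (+-assoc _ _ _))

  Δℕ-comm : ∀ (K : ℕ → ℕ → C) n → Δℕ K n ≈ Δℕ (λ i j → K j i) n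
  Δℕ-comm K zero = refl
  Δℕ-comm K (suc n) = begin
      K 0 (suc n) + Δℕ (λ i j → K (suc i) j) n ≈⟨ +-congˡ (Δℕ-comm (λ i j → K (suc i) j) n) ⟩
      K 0 (suc n) + Δℕ (λ i j → K (suc j) i) n ≈⟨ +-comm _ _ ⟩
      Δℕ (λ i j → K (suc j) i) n + K 0 (suc n) ≈⟨ sym (Δℕ-peel (λ i j → K j i) n) ⟩
      Δℕ (λ i j → K j i) (suc n) ∎

  infixl 7 _⊛_
  _⊛_ : (ℕ → C) → (ℕ → C) → ℕ → C
  a ⊛ b = Δℕ (λ i j → a i * b j)

  ⊛-cong : ∀ {a a′ b b′ : ℕ → C} → (∀ i → a i ≈ a′ i) → (∀ j → b j ≈ b′ j) → ∀ n → (a ⊛ b) n ≈ (a′ ⊛ b′) n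
  ⊛-cong ha hb n = Δℕ-cong n (λ i j → *-cong (ha i) (hb j))

  ⊛-comm : ∀ a b n → (a ⊛ b) n ≈ (b ⊛ a) n
  ⊛-comm a b n = trans (Δℕ-comm _ n) (Δℕ-cong n (λ i j → *-comm _ _))

  ⊛-assoc : ∀ a b d n → ((a ⊛ b) ⊛ d) n ≈ (a ⊛ (b ⊛ d)) n
  ⊛-assoc a b d t = begin
        Δℕ (λ u v → Δℕ (λ u1 v1 → a u1 * b v1) u * d v) t
        ≈⟨ Δℕ-cong t (λ u v → sym (Δℕ-*ʳ (d v) (λ u1 v1 → a u1 * b v1) u)) ⟩
        Δℕ (λ u v → Δℕ (λ u1 v1 → (a u1 * b v1) * d v) u) t
        ≈⟨ Δℕ-assoc (λ u1 v1 v → (a u1 * b v1) * d v) t ⟩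
        Δℕ (λ u1 w → Δℕ (λ v1 v → (a u1 * b v1) * d v) w) t
        ≈⟨ Δℕ-cong t (λ u1 w → trans (Δℕ-cong w (λ v1 v → *-assoc _ _ _)) (Δℕ-*ˡ (a u1) (λ v1 v → b v1 * d v) w)) ⟩
        Δℕ (λ u1 w → a u1 * Δℕ (λ v1 v → b v1 * d v) w) t
      ∎

  ⊛-distribˡ-+ : ∀ a b b′ n → (a ⊛ (λ j → b j + b′ j)) n ≈ (a ⊛ b) n + (a ⊛ b′) n
  ⊛-distribˡ-+ a b b′ n = trans (Δℕ-cong n (λ i j → distribˡ _ _ _)) (Δℕ-+ _ _ n)

  ⊛-*ʳ : ∀ k a b n → (a ⊛ (λ j → k * b j)) n ≈ k * (a ⊛ b) n
  ⊛-*ʳ k a b n = trans (Δℕ-cong n (λ i j → x*yz≈y*xz _ _ _)) (Δℕ-*ˡ k _ n)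

  sumUpTo : ℕ → (ℕ → C) → C
  sumUpTo zero f = f 0
  sumUpTo (suc M) f = f 0 + sumUpTo M (λ r → f (suc r))

  sumUpTo-cong : ∀ M {f g : ℕ → C} → (∀ r → f r ≈ g r) → sumUpTo M f ≈ sumUpTo M g
  sumUpTo-cong zero h = h 0
  sumUpTo-cong (suc M) h = +-cong (h 0) (sumUpTo-cong M (λ r → h (suc r)))

  sumUpTo-zero : ∀ M {f : ℕ → C} → (∀ r → f r ≈ 0#) → sumUpTo M f ≈ 0#
  sumUpTo-zero zero h = h 0
  sumUpTo-zero (suc M) h = trans (+-cong (h 0) (sumUpTo-zero M (λ r → h (suc r)))) (+-identityˡ 0#)

  sumUpTo-* : ∀ M k (f : ℕ → C) → sumUpTo M (λ r → k * f r) ≈ k * sumUpTo M f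
  sumUpTo-* zero k f = refl
  sumUpTo-* (suc M) k f = trans (+-congˡ (sumUpTo-* M k _)) (sym (distribˡ k _ _))

  sumUpTo-suc : ∀ M (f : ℕ → C) → sumUpTo (suc M) f ≈ sumUpTo M f + f (suc M)
  sumUpTo-suc zero f = refl
  sumUpTo-suc (suc M) f = trans (+-congˡ (sumUpTo-suc M (λ r → f (suc r)))) (sym (+-assoc _ _ _))

  ⊛-sumUpTo : ∀ M a (G : ℕ → ℕ → C) n → (a ⊛ (λ j → sumUpTo M (λ r → G r j))) n ≈ sumUpTo M (λ r → (a ⊛ G r) n)
  ⊛-sumUpTo zero a G n = refl
  ⊛-sumUpTo (suc M) a G n = trans (⊛-distribˡ-+ a (G 0) _ n) (+-congˡ (⊛-sumUpTo M a (λ r → G (suc r)) n))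

  artanh : ℕ → C
  artanh n = if isEven n then 0# else recip n

  oddIndicator evenIndicator : ℕ → C
  oddIndicator n = if isEven n then 0# else 1#
  evenIndicator n = if isEven n then 1# else 0#

  δ₀ : ℕ → C
  δ₀ zero = 1#
  δ₀ (suc _) = 0#

  artanh^ : ℕ → ℕ → C
  artanh^ zero = δ₀
  artanh^ (suc r) = artanh ⊛ artanh^ r

  xD-artanh : ∀ n → fromℕ n * artanh n ≈ oddIndicator n
  xD-artanh n with isEven n in eq
  ... | true = zeroʳ _
  ... | false = fromℕ*recip n (odd⇒1≤ n eq)

  oddIndicator-+2 : ∀ i → oddIndicator (suc (suc i)) ≈ oddIndicator i
  oddIndicator-+2 i with isEven i
  ... | true = refl
  ... | false = refl

  xD : (ℕ → C) → ℕ → C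
  xD a i = fromℕ i * a i

  Δℕ-fromℕ* : ∀ (K : ℕ → ℕ → C) n → fromℕ n * Δℕ K n ≈ Δℕ (λ i j → (fromℕ i + fromℕ j) * K i j) n
  Δℕ-fromℕ* K zero = trans (zeroˡ _) (sym (trans (*-congʳ (+-identityˡ 0#)) (zeroˡ _)))
  Δℕ-fromℕ* K (suc n) = begin
    (1# + fromℕ n) * (K 0 (suc n) + Δℕ K′ n)
      ≈⟨ distribˡ _ _ _ ⟩
    (1# + fromℕ n) * K 0 (suc n) + (1# + fromℕ n) * Δℕ K′ n
      ≈⟨ +-cong (*-congʳ (sym (+-identityˡ _))) ([1+x]*y≈y+x*y _ _) ⟩
    (0# + (1# + fromℕ n)) * K 0 (suc n) + (Δℕ K′ n + fromℕ n * Δℕ K′ n)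
      ≈⟨ +-congˡ (trans (+-congˡ (Δℕ-fromℕ* K′ n)) (sym (Δℕ-+ _ _ n))) ⟩
    (0# + (1# + fromℕ n)) * K 0 (suc n) + Δℕ (λ i j → K′ i j + (fromℕ i + fromℕ j) * K′ i j) n
      ≈⟨ +-congˡ (Δℕ-cong n (λ i j → sym (trans (*-congʳ (+-assoc _ _ _)) ([1+x]*y≈y+x*y _ _)))) ⟩
    (0# + (1# + fromℕ n)) * K 0 (suc n) + Δℕ (λ i j → ((1# + fromℕ i) + fromℕ j) * K′ i j) n ∎
    where
    K′ : ℕ → ℕ → C
    K′ i j = K (suc i) j

  xD-⊛ : ∀ a b n → fromℕ n * (a ⊛ b) n ≈ (xD a ⊛ b) n + (a ⊛ xD b) n
  xD-⊛ a b n = begin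
    fromℕ n * (a ⊛ b) n                                ≈⟨ Δℕ-fromℕ* _ n ⟩
    Δℕ (λ i j → (fromℕ i + fromℕ j) * (a i * b j)) n  ≈⟨ Δℕ-cong n leibniz ⟩
    Δℕ (λ i j → xD a i * b j + a i * xD b j) n        ≈⟨ Δℕ-+ _ _ n ⟩
    (xD a ⊛ b) n + (a ⊛ xD b) n                       ∎
    where
    leibniz : ∀ i j → (fromℕ i + fromℕ j) * (a i * b j) ≈ xD a i * b j + a i * xD b j
    leibniz i j = trans (distribʳ _ _ _) (+-cong (sym (*-assoc _ _ _)) (x*yz≈y*xz _ _ _))

  xD-artanh^ : ∀ r n → fromℕ n * artanh^ (suc r) n ≈ fromℕ (suc r) * (oddIndicator ⊛ artanh^ r) n
  xD-artanh^ zero n = begin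
      fromℕ n * (artanh ⊛ δ₀) n
        ≈⟨ xD-⊛ artanh δ₀ n ⟩
      (xD artanh ⊛ δ₀) n + (artanh ⊛ xD δ₀) n
        ≈⟨ +-cong (⊛-cong xD-artanh (λ j → refl) n) (trans (⊛-cong (λ i → refl) Nδ n) (Δℕ-zero n (λ i j _ → zeroʳ _))) ⟩
      (oddIndicator ⊛ δ₀) n + 0#
        ≈⟨ +-identityʳ _ ⟩
      (oddIndicator ⊛ δ₀) n
        ≈⟨ sym (trans ([1+x]*y≈y+x*y 0# _) (trans (+-congˡ (zeroˡ _)) (+-identityʳ _))) ⟩
      (1# + 0#) * (oddIndicator ⊛ δ₀) n ∎
    where
    Nδ : ∀ j → xD δ₀ j ≈ 0#
    Nδ zero = zeroˡ _
    Nδ (suc j) = zeroʳ _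
  xD-artanh^ (suc r) n = begin
      fromℕ n * (artanh ⊛ (artanh^ (suc r))) n
        ≈⟨ xD-⊛ artanh (artanh^ (suc r)) n ⟩
      (xD artanh ⊛ (artanh^ (suc r))) n + (artanh ⊛ (xD (artanh^ (suc r)))) n
        ≈⟨ +-cong (⊛-cong xD-artanh (λ j → refl) n) (⊛-cong (λ i → refl) (λ j → xD-artanh^ r j) n) ⟩
      (oddIndicator ⊛ (artanh^ (suc r))) n + (artanh ⊛ (λ j → fromℕ (suc r) * (oddIndicator ⊛ artanh^ r) j)) n
        ≈⟨ +-congˡ (⊛-*ʳ _ artanh _ n) ⟩
      (oddIndicator ⊛ (artanh^ (suc r))) n + fromℕ (suc r) * (artanh ⊛ (oddIndicator ⊛ artanh^ r)) n
        ≈⟨ +-congˡ (*-congˡ swap) ⟩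
      (oddIndicator ⊛ (artanh^ (suc r))) n + fromℕ (suc r) * (oddIndicator ⊛ (artanh^ (suc r))) n
        ≈⟨ sym ([1+x]*y≈y+x*y _ _) ⟩
      (1# + fromℕ (suc r)) * (oddIndicator ⊛ (artanh^ (suc r))) n ∎
    where
    swap : (artanh ⊛ (oddIndicator ⊛ artanh^ r)) n ≈ (oddIndicator ⊛ (artanh ⊛ artanh^ r)) n
    swap = begin
      (artanh ⊛ (oddIndicator ⊛ artanh^ r)) n ≈⟨ sym (⊛-assoc artanh oddIndicator (artanh^ r) n) ⟩
      ((artanh ⊛ oddIndicator) ⊛ artanh^ r) n ≈⟨ ⊛-cong (λ i → ⊛-comm artanh oddIndicator i) (λ j → refl) n ⟩
      ((oddIndicator ⊛ artanh) ⊛ artanh^ r) n ≈⟨ ⊛-assoc oddIndicator artanh (artanh^ r) n ⟩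
      (oddIndicator ⊛ (artanh ⊛ artanh^ r)) n ∎

  artanh^-vanish : ∀ r n → n < r → artanh^ r n ≈ 0#
  artanh^-vanish (suc r) n le = Δℕ-zero n vanishes
    where
    vanishes : ∀ i j → i ℕ.+ j ≡ n → artanh i * artanh^ r j ≈ 0#
    vanishes zero j e = zeroˡ _
    vanishes (suc i) j e = trans (*-congˡ (artanh^-vanish r j lt)) (zeroʳ _)
      where
      lt : j < r
      lt = ℕP.≤-trans (s≤s (ℕP.m≤n+m j i)) (ℕP.≤-pred (P.subst (λ m → suc m ≤ suc r) (P.sym e) le))

  artanh^-parity : ∀ r n → isEven r ≡ not (isEven n) → artanh^ r n ≈ 0#
  artanh^-parity zero zero ()
  artanh^-parity zero (suc n) e = refl
  artanh^-parity (suc r) n e = Δℕ-zero n vanishes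
    where
    vanishes : ∀ i j → i ℕ.+ j ≡ n → artanh i * artanh^ r j ≈ 0#
    vanishes i j eij with isEven i in oi
    ... | true = zeroˡ _
    ... | false = trans (*-congˡ (artanh^-parity r j q)) (zeroʳ _)
      where
      i+j~j : isEven (i ℕ.+ j) ≡ not (isEven j)
      i+j~j = P.trans (isEven-+ i j) (P.cong (λ b → if b then isEven j else not (isEven j)) oi)
      q : isEven r ≡ not (isEven j)
      q = not-injective (P.trans e (P.cong not (P.trans (P.cong isEven (P.sym eij)) i+j~j)))

  expArtanh : ℕ → ℕ → C
  expArtanh M n = sumUpTo M (λ r → recip (r !) * artanh^ r n)

  xD-expArtanh : ∀ M n → fromℕ n * expArtanh (suc M) n ≈ (oddIndicator ⊛ expArtanh M) n
  xD-expArtanh M n = begin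
      fromℕ n * (recip 1 * δ₀ n + sumUpTo M (λ r → recip (suc r !) * artanh^ (suc r) n))
        ≈⟨ distribˡ _ _ _ ⟩
      fromℕ n * (recip 1 * δ₀ n) + fromℕ n * sumUpTo M (λ r → recip (suc r !) * artanh^ (suc r) n)
        ≈⟨ +-cong (first n) (sym (sumUpTo-* M _ _)) ⟩
      0# + sumUpTo M (λ r → fromℕ n * (recip (suc r !) * artanh^ (suc r) n))
        ≈⟨ +-identityˡ _ ⟩
      sumUpTo M (λ r → fromℕ n * (recip (suc r !) * artanh^ (suc r) n))
        ≈⟨ sumUpTo-cong M step ⟩
      sumUpTo M (λ r → (oddIndicator ⊛ (λ j → recip (r !) * artanh^ r j)) n)
        ≈⟨ sym (⊛-sumUpTo M oddIndicator _ n) ⟩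
      (oddIndicator ⊛ expArtanh M) n ∎
    where
    first : ∀ n → fromℕ n * (recip 1 * δ₀ n) ≈ 0#
    first zero = zeroˡ _
    first (suc n) = trans (*-congˡ (zeroʳ _)) (zeroʳ _)
    step : ∀ r → fromℕ n * (recip (suc r !) * artanh^ (suc r) n) ≈ (oddIndicator ⊛ (λ j → recip (r !) * artanh^ r j)) n
    step r = begin
      fromℕ n * (recip (suc r !) * artanh^ (suc r) n)
        ≈⟨ x*yz≈y*xz _ _ _ ⟩
      recip (suc r !) * (fromℕ n * artanh^ (suc r) n)
        ≈⟨ *-congˡ (xD-artanh^ r n) ⟩
      recip (suc r !) * (fromℕ (suc r) * (oddIndicator ⊛ artanh^ r) n)
        ≈⟨ trans (sym (*-assoc _ _ _)) (*-congʳ (*-comm _ _)) ⟩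
      (fromℕ (suc r) * recip (suc r !)) * (oddIndicator ⊛ artanh^ r) n
        ≈⟨ *-congʳ (fromℕ-suc*recip-! r) ⟩
      recip (r !) * (oddIndicator ⊛ artanh^ r) n
        ≈⟨ sym (⊛-*ʳ _ oddIndicator (artanh^ r) n) ⟩
      (oddIndicator ⊛ (λ j → recip (r !) * artanh^ r j)) n ∎

  oddIndicator-⊛-+2 : ∀ φ n → (oddIndicator ⊛ φ) (suc (suc n)) ≈ φ (suc n) + (oddIndicator ⊛ φ) n
  oddIndicator-⊛-+2 φ n = begin
      0# * φ (suc (suc n)) + (1# * φ (suc n) + Δℕ (λ i j → oddIndicator (suc (suc i)) * φ j) n)
        ≈⟨ +-cong (zeroˡ _) (+-cong (*-identityˡ _) (Δℕ-cong n (λ i j → *-congʳ (oddIndicator-+2 i)))) ⟩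
      0# + (φ (suc n) + (oddIndicator ⊛ φ) n)
        ≈⟨ +-identityˡ _ ⟩
      φ (suc n) + (oddIndicator ⊛ φ) n ∎

  expArtanh-truncate : ∀ M n → n < suc M → expArtanh (suc M) n ≈ expArtanh M n
  expArtanh-truncate M n lt = trans (sumUpTo-suc M _) (trans (+-congˡ (trans (*-congˡ (artanh^-vanish (suc M) n lt)) (zeroʳ _))) (+-identityʳ _))

  -- exp(artanh x) = (1+x)/√(1−x²) has equal coefficients at 2m and 2m+1; this is read off
  -- the differential equation x·e′ = x/(1−x²)·e of xD-expArtanh.
  expArtanh-even : ∀ M k → isEven k ≡ true → suc k ≤ suc M →
    (expArtanh (suc M) (suc k) ≈ expArtanh (suc M) k) ×
    ((oddIndicator ⊛ expArtanh M) (suc k) ≈ (oddIndicator ⊛ expArtanh M) k + expArtanh (suc M) k)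
  expArtanh-even M zero _ _ = E1≈E0 , T1≈T0+E0
    where
    E = expArtanh (suc M)
    T = oddIndicator ⊛ expArtanh M
    T1≈E0 : T 1 ≈ E 0
    T1≈E0 = trans (+-cong (zeroˡ _) (*-identityˡ _))
                  (trans (+-identityˡ _) (sym (expArtanh-truncate M 0 (s≤s z≤n))))
    T1≈T0+E0 : T 1 ≈ T 0 + E 0
    T1≈T0+E0 = trans T1≈E0 (sym (trans (+-congʳ (zeroˡ _)) (+-identityˡ _)))
    E1≈E0 : E 1 ≈ E 0
    E1≈E0 = fromℕ-suc-cancelˡ 0 (begin
      fromℕ 1 * E 1   ≈⟨ xD-expArtanh M 1 ⟩
      T 1             ≈⟨ T1≈E0 ⟩
      E 0             ≈⟨ sym (trans ([1+x]*y≈y+x*y 0# _) (trans (+-congˡ (zeroˡ _)) (+-identityʳ _))) ⟩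
      fromℕ 1 * E 0   ∎)
  expArtanh-even M (suc zero) () _
  expArtanh-even M (suc (suc k)) ev le = E3≈E2 , T3≈T2+E2
    where
    E = expArtanh (suc M)
    T = oddIndicator ⊛ expArtanh M
    IH = expArtanh-even M k (P.trans (P.sym (isEven-+2 k)) ev) (ℕP.≤-trans (ℕP.n≤1+n _) (ℕP.≤-trans (ℕP.n≤1+n _) le))
    T2≈T1 : T (2 ℕ.+ k) ≈ T (1 ℕ.+ k)
    T2≈T1 = begin
      T (2 ℕ.+ k)
        ≈⟨ oddIndicator-⊛-+2 (expArtanh M) k ⟩
      expArtanh M (1 ℕ.+ k) + T k
        ≈⟨ +-congʳ (sym (expArtanh-truncate M (suc k) (ℕP.≤-trans (ℕP.n≤1+n _) le))) ⟩
      E (1 ℕ.+ k) + T k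
        ≈⟨ +-congʳ (proj₁ IH) ⟩
      E k + T k
        ≈⟨ +-comm _ _ ⟩
      T k + E k
        ≈⟨ sym (proj₂ IH) ⟩
      T (1 ℕ.+ k) ∎
    T3≈T2+E2 : T (3 ℕ.+ k) ≈ T (2 ℕ.+ k) + E (2 ℕ.+ k)
    T3≈T2+E2 = begin
      T (3 ℕ.+ k)
        ≈⟨ oddIndicator-⊛-+2 (expArtanh M) (suc k) ⟩
      expArtanh M (2 ℕ.+ k) + T (1 ℕ.+ k)
        ≈⟨ +-cong (sym (expArtanh-truncate M (suc (suc k)) le)) (sym T2≈T1) ⟩
      E (2 ℕ.+ k) + T (2 ℕ.+ k)
        ≈⟨ +-comm _ _ ⟩
      T (2 ℕ.+ k) + E (2 ℕ.+ k) ∎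
    E3≈E2 : E (3 ℕ.+ k) ≈ E (2 ℕ.+ k)
    E3≈E2 = fromℕ-suc-cancelˡ (2 ℕ.+ k) (begin
      fromℕ (3 ℕ.+ k) * E (3 ℕ.+ k)                  ≈⟨ xD-expArtanh M (3 ℕ.+ k) ⟩
      T (3 ℕ.+ k)                                    ≈⟨ T3≈T2+E2 ⟩
      T (2 ℕ.+ k) + E (2 ℕ.+ k)                      ≈⟨ +-comm _ _ ⟩
      E (2 ℕ.+ k) + T (2 ℕ.+ k)                      ≈⟨ +-congˡ (sym (xD-expArtanh M (2 ℕ.+ k))) ⟩
      E (2 ℕ.+ k) + fromℕ (2 ℕ.+ k) * E (2 ℕ.+ k)    ≈⟨ sym ([1+x]*y≈y+x*y _ _) ⟩
      fromℕ (3 ℕ.+ k) * E (2 ℕ.+ k)                  ∎)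

  expArtanh-odd≈even : ∀ M k → isEven k ≡ true → suc k ≤ M → expArtanh M (suc k) ≈ expArtanh M k
  expArtanh-odd≈even (suc M) k ev le = proj₁ (expArtanh-even M k ev le)

  sinhCoeff : ℕ → C
  sinhCoeff r = if isEven r then 0# else recip (r !)

  coshCoeff : ℕ → C
  coshCoeff r = if isEven r then recip (r !) else 0#

  sinhArtanh : ℕ → ℕ → C
  sinhArtanh M n = sumUpTo M (λ r → sinhCoeff r * artanh^ r n)

  coshArtanh : ℕ → ℕ → C
  coshArtanh M n = sumUpTo M (λ r → coshCoeff r * artanh^ r n)

  -- sinh(artanh x) = x/√(1−x²) = x·cosh(artanh x).
  sinhArtanh-suc≈coshArtanh : ∀ M k → suc k ≤ M → sinhArtanh M (suc k) ≈ coshArtanh M k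
  sinhArtanh-suc≈coshArtanh M k le with isEven k in ek
  ... | true = trans (sumUpTo-cong M s1) (trans (expArtanh-odd≈even M k ek le) (sym (sumUpTo-cong M s2)))
    where
    s1 : ∀ r → sinhCoeff r * artanh^ r (suc k) ≈ recip (r !) * artanh^ r (suc k)
    s1 r with isEven r in er
    ... | true = trans (zeroˡ _) (sym (trans (*-congˡ (artanh^-parity r (suc k) (P.trans er (P.cong (not ∘ not) (P.sym ek))))) (zeroʳ _)))
    ... | false = refl
    s2 : ∀ r → coshCoeff r * artanh^ r k ≈ recip (r !) * artanh^ r k
    s2 r with isEven r in er
    ... | true = refl
    ... | false = trans (zeroˡ _) (sym (trans (*-congˡ (artanh^-parity r k (P.trans er (P.cong not (P.sym ek))))) (zeroʳ _)))
  ... | false = trans (sumUpTo-zero M s1) (sym (sumUpTo-zero M s2))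
    where
    s1 : ∀ r → sinhCoeff r * artanh^ r (suc k) ≈ 0#
    s1 r with isEven r in er
    ... | true = zeroˡ _
    ... | false = trans (*-congˡ (artanh^-parity r (suc k) (P.trans er (P.cong not (P.cong not (P.sym ek)))))) (zeroʳ _)
    s2 : ∀ r → coshCoeff r * artanh^ r k ≈ 0#
    s2 r with isEven r in er
    ... | true = trans (*-congˡ (artanh^-parity r k (P.trans er (P.cong not (P.sym ek))))) (zeroʳ _)
    ... | false = zeroˡ _

  signedOdd : (ℕ → C) → List ℕ → C
  signedOdd φ w = if emptyOrLastOdd w then sign (evenCount w) * φ (oddCount w) else 0#

  signedOdd-true : ∀ φ w → emptyOrLastOdd w ≡ true → signedOdd φ w ≈ sign (evenCount w) * φ (oddCount w)
  signedOdd-true φ w e rewrite e = refl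

  signedOdd-false : ∀ φ w → emptyOrLastOdd w ≡ false → signedOdd φ w ≈ 0#
  signedOdd-false φ w e rewrite e = refl

  signedOdd-cong : ∀ φ φ′ w → φ (oddCount w) ≈ φ′ (oddCount w) → signedOdd φ w ≈ signedOdd φ′ w
  signedOdd-cong φ φ′ w h with emptyOrLastOdd w
  ... | true = *-congˡ h
  ... | false = refl

  signedOdd-odd∷ : ∀ φ x → isEven x ≡ false → ∀ u → signedOdd φ (x ∷ u) ≈ signedOdd (λ n → φ (suc n)) u
  signedOdd-odd∷ φ x ex [] rewrite ex = refl
  signedOdd-odd∷ φ x ex (y ∷ u) rewrite ex = refl

  signedOdd-even[] : ∀ φ x → isEven x ≡ true → signedOdd φ (x ∷ []) ≈ 0#
  signedOdd-even[] φ x ex rewrite ex = refl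

  signedOdd-even∷ : ∀ φ x → isEven x ≡ true → ∀ y u → signedOdd φ (x ∷ y ∷ u) ≈ - signedOdd φ (y ∷ u)
  signedOdd-even∷ φ x ex y u rewrite ex with emptyOrLastOdd (y ∷ u)
  ... | true = sym (-‿distribˡ-* _ _)
  ... | false = sym -0#≈0#

  signedOdd-linear : ∀ a f g w → signedOdd (λ n → a * f n + g n) w ≈ a * signedOdd f w + signedOdd g w
  signedOdd-linear a f g w with emptyOrLastOdd w
  ... | true = trans (distribˡ _ _ _) (+-congʳ (x*yz≈y*xz _ _ _))
  ... | false = sym (trans (+-congʳ (zeroʳ a)) (+-identityˡ 0#))

  signedOdd-⋆ : ∀ φ ψ w → (signedOdd φ ⋆ signedOdd ψ) w ≈ signedOdd (φ ⊛ ψ) w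
  signedOdd-⋆ φ ψ [] = trans (*-cong (*-identityˡ _) (*-identityˡ _)) (sym (*-identityˡ _))
  signedOdd-⋆ φ ψ (x ∷ t) = go (isEven x) P.refl
   where
   go : ∀ b → isEven x ≡ b → (signedOdd φ ⋆ signedOdd ψ) (x ∷ t) ≈ signedOdd (φ ⊛ ψ) (x ∷ t)
   go false ex = begin
      signedOdd φ [] * signedOdd ψ (x ∷ t) + ((λ u → signedOdd φ (x ∷ u)) ⋆ signedOdd ψ) t
        ≈⟨ +-cong (*-cong (*-identityˡ _) (signedOdd-odd∷ ψ x ex t))
                  (⋆-cong t (λ u v _ → signedOdd-odd∷ φ x ex u) (λ u v _ → refl)) ⟩
      φ 0 * signedOdd (λ n → ψ (suc n)) t + ((signedOdd (λ n → φ (suc n))) ⋆ signedOdd ψ) t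
        ≈⟨ +-congˡ (signedOdd-⋆ (λ n → φ (suc n)) ψ t) ⟩
      φ 0 * signedOdd (λ n → ψ (suc n)) t + signedOdd ((λ n → φ (suc n)) ⊛ ψ) t
        ≈⟨ sym (signedOdd-linear (φ 0) (λ n → ψ (suc n)) ((λ n → φ (suc n)) ⊛ ψ) t) ⟩
      signedOdd (λ n → (φ ⊛ ψ) (suc n)) t
        ≈⟨ sym (signedOdd-odd∷ (φ ⊛ ψ) x ex t) ⟩
      signedOdd (φ ⊛ ψ) (x ∷ t) ∎
   go true ex = begin
      signedOdd φ [] * signedOdd ψ (x ∷ t) + ((λ u → signedOdd φ (x ∷ u)) ⋆ signedOdd ψ) t
        ≈⟨ +-congˡ (⋆-cong t (λ u v _ → shift u) (λ u v _ → refl)) ⟩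
      signedOdd φ [] * signedOdd ψ (x ∷ t) + ((λ u → - signedOdd φ u + signedOdd φ [] * δ[] u) ⋆ signedOdd ψ) t
        ≈⟨ +-congˡ (⋆-distribʳ-+ _ _ _ t) ⟩
      signedOdd φ [] * signedOdd ψ (x ∷ t)
        + (((λ u → - signedOdd φ u) ⋆ signedOdd ψ) t + ((λ u → signedOdd φ [] * δ[] u) ⋆ signedOdd ψ) t)
        ≈⟨ +-congˡ (+-cong (trans (⋆-negˡ _ _ t) (-‿cong (signedOdd-⋆ φ ψ t)))
                           (trans (⋆-*ˡ _ δ[] _ t) (*-congˡ (⋆-identityˡ _ t)))) ⟩
      signedOdd φ [] * signedOdd ψ (x ∷ t) + (- signedOdd (φ ⊛ ψ) t + signedOdd φ [] * signedOdd ψ t)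
        ≈⟨ fin t ⟩
      signedOdd (φ ⊛ ψ) (x ∷ t) ∎
    where
    shift : ∀ u → signedOdd φ (x ∷ u) ≈ - signedOdd φ u + signedOdd φ [] * δ[] u
    shift [] = trans (signedOdd-even[] φ x ex) (sym (trans (+-congˡ (*-identityʳ _)) (-‿inverseˡ _)))
    shift (y ∷ u) = trans (signedOdd-even∷ φ x ex y u) (sym (trans (+-congˡ (zeroʳ _)) (+-identityʳ _)))
    fin : ∀ t → signedOdd φ [] * signedOdd ψ (x ∷ t) + (- signedOdd (φ ⊛ ψ) t + signedOdd φ [] * signedOdd ψ t)
                  ≈ signedOdd (φ ⊛ ψ) (x ∷ t)
    fin [] = begin
      signedOdd φ [] * signedOdd ψ (x ∷ []) + (- signedOdd (φ ⊛ ψ) [] + signedOdd φ [] * signedOdd ψ [])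
        ≈⟨ +-cong (trans (*-congˡ (signedOdd-even[] ψ x ex)) (zeroʳ _))
                  (+-congˡ (trans (*-cong (*-identityˡ _) (*-identityˡ _)) (sym (*-identityˡ _)))) ⟩
      0# + (- signedOdd (φ ⊛ ψ) [] + signedOdd (φ ⊛ ψ) [])
        ≈⟨ trans (+-identityˡ _) (-‿inverseˡ _) ⟩
      0#
        ≈⟨ sym (signedOdd-even[] (φ ⊛ ψ) x ex) ⟩
      signedOdd (φ ⊛ ψ) (x ∷ []) ∎
    fin (y ∷ t) = begin
      signedOdd φ [] * signedOdd ψ (x ∷ y ∷ t) + (- signedOdd (φ ⊛ ψ) (y ∷ t) + signedOdd φ [] * signedOdd ψ (y ∷ t))
        ≈⟨ +-congʳ (trans (*-congˡ (signedOdd-even∷ ψ x ex y t)) (sym (-‿distribʳ-* _ _))) ⟩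
      - (signedOdd φ [] * signedOdd ψ (y ∷ t)) + (- signedOdd (φ ⊛ ψ) (y ∷ t) + signedOdd φ [] * signedOdd ψ (y ∷ t))
        ≈⟨ -x+[y+x]≈y _ _ ⟩
      - signedOdd (φ ⊛ ψ) (y ∷ t)
        ≈⟨ sym (signedOdd-even∷ (φ ⊛ ψ) x ex y t) ⟩
      signedOdd (φ ⊛ ψ) (x ∷ y ∷ t) ∎

  -- oddBlockSum g wt substitutes the series of g on odd-sum compositions into the power series wt.
  oddBlockTerm : (List ℕ → C) → (ℕ → C) → List (List ℕ) → C
  oddBlockTerm g wt bs = if allOdd (map sum bs) then Π (map g bs) * wt (length bs) else 0#

  oddBlockSum : (List ℕ → C) → (ℕ → C) → List ℕ → C
  oddBlockSum g wt = Σsplits (oddBlockTerm g wt)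

  oddBlockTerm-odd∷ : ∀ g wt b bs → isEven (sum b) ≡ false →
    oddBlockTerm g wt (b ∷ bs) ≈ g b * oddBlockTerm g (wt ∘ suc) bs
  oddBlockTerm-odd∷ g wt b bs eb rewrite eb with allOdd (map sum bs)
  ... | true = *-assoc _ _ _
  ... | false = sym (zeroʳ _)

  oddBlockTerm-even∷ : ∀ g wt b bs → isEven (sum b) ≡ true → oddBlockTerm g wt (b ∷ bs) ≈ 0#
  oddBlockTerm-even∷ g wt b bs eb rewrite eb = refl

  oddBlockTerm-linear : ∀ g k w₁ w₂ bs →
    oddBlockTerm g (λ n → k * w₁ n + w₂ n) bs ≈ k * oddBlockTerm g w₁ bs + oddBlockTerm g w₂ bs
  oddBlockTerm-linear g k w₁ w₂ bs with allOdd (map sum bs)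
  ... | true = trans (distribˡ _ _ _) (+-congʳ (x*yz≈y*xz _ _ _))
  ... | false = sym (trans (+-congʳ (zeroʳ k)) (+-identityˡ 0#))

  oddBlockTerm-cong : ∀ g {w w′} → (∀ n → w n ≈ w′ n) → ∀ bs → oddBlockTerm g w bs ≈ oddBlockTerm g w′ bs
  oddBlockTerm-cong g h bs with allOdd (map sum bs)
  ... | true = *-congˡ (h _)
  ... | false = refl

  Δ-oddBlockTerm : ∀ g a b bs → Δ (λ b1 b2 → oddBlockTerm g a b1 * oddBlockTerm g b b2) bs ≈ oddBlockTerm g (a ⊛ b) bs
  Δ-oddBlockTerm g a b [] = trans (*-cong (*-identityˡ _) (*-identityˡ _)) (sym (*-identityˡ _))
  Δ-oddBlockTerm g a b (x ∷ r) = byParity (isEven (sum x)) P.refl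
    where
    byParity : ∀ p → isEven (sum x) ≡ p →
      Δ (λ b1 b2 → oddBlockTerm g a b1 * oddBlockTerm g b b2) (x ∷ r) ≈ oddBlockTerm g (a ⊛ b) (x ∷ r)
    byParity false ex = begin
      oddBlockTerm g a [] * oddBlockTerm g b (x ∷ r) + Δ (λ b1 b2 → oddBlockTerm g a (x ∷ b1) * oddBlockTerm g b b2) r
        ≈⟨ +-cong (*-cong (*-identityˡ _) (oddBlockTerm-odd∷ g b x r ex))
                  (Δ-cong′ r (λ b1 b2 → trans (*-congʳ (oddBlockTerm-odd∷ g a x b1 ex)) (*-assoc _ _ _))) ⟩
      a 0 * (g x * oddBlockTerm g (λ n → b (suc n)) r) + Δ (λ b1 b2 → g x * (oddBlockTerm g (λ n → a (suc n)) b1 * oddBlockTerm g b b2)) r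
        ≈⟨ +-cong (x*yz≈y*xz _ _ _) (trans (Δ-*ˡ (g x) _ r) (*-congˡ (Δ-oddBlockTerm g (λ n → a (suc n)) b r))) ⟩
      g x * (a 0 * oddBlockTerm g (λ n → b (suc n)) r) + g x * oddBlockTerm g ((λ n → a (suc n)) ⊛ b) r
        ≈⟨ sym (distribˡ _ _ _) ⟩
      g x * (a 0 * oddBlockTerm g (λ n → b (suc n)) r + oddBlockTerm g ((λ n → a (suc n)) ⊛ b) r)
        ≈⟨ *-congˡ (sym (oddBlockTerm-linear g (a 0) (λ n → b (suc n)) ((λ n → a (suc n)) ⊛ b) r)) ⟩
      g x * oddBlockTerm g (λ n → (a ⊛ b) (suc n)) r
        ≈⟨ sym (oddBlockTerm-odd∷ g (a ⊛ b) x r ex) ⟩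
      oddBlockTerm g (a ⊛ b) (x ∷ r) ∎
    byParity true ex = trans (+-cong (trans (*-congˡ (oddBlockTerm-even∷ g b x r ex)) (zeroʳ _))
                                    (Δ-zero r (λ b1 b2 _ → trans (*-congʳ (oddBlockTerm-even∷ g a x b1 ex)) (zeroˡ _))))
                    (trans (+-identityˡ 0#) (sym (oddBlockTerm-even∷ g (a ⊛ b) x r ex)))

  oddBlockSum-⋆ : ∀ g a b w → (oddBlockSum g a ⋆ oddBlockSum g b) w ≈ oddBlockSum g (a ⊛ b) w
  oddBlockSum-⋆ g a b w = trans (⋆-Σsplits _ _ w) (Σsplits-cong′ w (Δ-oddBlockTerm g a b))

  oddBlockSum-cong : ∀ g {a a′} → (∀ n → a n ≈ a′ n) → ∀ w → oddBlockSum g a w ≈ oddBlockSum g a′ w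
  oddBlockSum-cong g h w = Σsplits-cong′ w (oddBlockTerm-cong g h)

  oddBlockSum-linear : ∀ g k w1 w2 w → oddBlockSum g (λ n → k * w1 n + w2 n) w ≈ k * oddBlockSum g w1 w + oddBlockSum g w2 w
  oddBlockSum-linear g k w1 w2 w = trans (Σsplits-cong′ w (oddBlockTerm-linear g k w1 w2)) (trans (Σsplits-+ _ _ w) (+-congʳ (Σsplits-* k _ w)))

  oddBlockSum-parity : ∀ g wt w → (∀ n → isEven n ≡ isEven (sum w) → wt n ≈ 0#) → oddBlockSum g wt w ≈ 0#
  oddBlockSum-parity g wt w wt≈0 = Σsplits-zero w vanishes
    where
    vanishes : ∀ bs → IsSplit w bs → oddBlockTerm g wt bs ≈ 0#
    vanishes bs (ecat , _) with allOdd (map sum bs) in e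
    ... | false = refl
    ... | true = trans (*-congˡ (wt≈0 (length bs) #blocks~sum)) (zeroʳ _)
      where
      #blocks~sum : isEven (length bs) ≡ isEven (sum w)
      #blocks~sum = P.trans (P.sym (P.trans (allOdd⇒isEven-sum≡isEven-length (map sum bs) e) (P.cong isEven (length-map sum bs))))
                            (P.cong isEven (P.trans (P.sym (sum-concat bs)) (P.cong sum ecat)))

  SinhRecursion : (List ℕ → C) → Set ℓ
  SinhRecursion G = ∀ a t → IsComp (a ∷ t) → isEven (sum (a ∷ t)) ≡ false →
    oddBlockSum G sinhCoeff (a ∷ t) + evenIndicator a * oddBlockSum G sinhCoeff t
      ≈ oddIndicator a * oddBlockSum G coshCoeff t

  multiBlockTerm : (List ℕ → C) → (ℕ → C) → List (List ℕ) → C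
  multiBlockTerm G wt bs = if hasTwoBlocks bs then oddBlockTerm G wt bs else 0#

  oddBlockSum-sinh-∷ : ∀ G x t → isEven (sum (x ∷ t)) ≡ false →
    oddBlockSum G sinhCoeff (x ∷ t) ≈ G (x ∷ t) + Σsplits (multiBlockTerm G sinhCoeff) (x ∷ t)
  oddBlockSum-sinh-∷ G x t es = begin
    oddBlockSum G sinhCoeff (x ∷ t)
      ≈⟨ Σsplits-cong′ (x ∷ t) split ⟩
    Σsplits (λ bs → singleBlockTerm bs + multiBlockTerm G sinhCoeff bs) (x ∷ t)
      ≈⟨ Σsplits-+ _ _ (x ∷ t) ⟩
    Σsplits singleBlockTerm (x ∷ t) + Σsplits (multiBlockTerm G sinhCoeff) (x ∷ t)
      ≈⟨ +-congʳ (Σsplits-singleBlock singleBlockTerm x t (λ _ _ _ _ → refl)) ⟩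
    oddBlockTerm G sinhCoeff [ x ∷ t ] + Σsplits (multiBlockTerm G sinhCoeff) (x ∷ t)
      ≈⟨ +-congʳ oneBlock ⟩
    G (x ∷ t) + Σsplits (multiBlockTerm G sinhCoeff) (x ∷ t) ∎
    where
    singleBlockTerm : List (List ℕ) → C
    singleBlockTerm bs = if hasTwoBlocks bs then 0# else oddBlockTerm G sinhCoeff bs
    split : ∀ bs → oddBlockTerm G sinhCoeff bs ≈ singleBlockTerm bs + multiBlockTerm G sinhCoeff bs
    split [] = sym (+-identityʳ _)
    split (b ∷ []) = sym (+-identityʳ _)
    split (b ∷ b′ ∷ r) = sym (+-identityˡ _)
    oneBlock : oddBlockTerm G sinhCoeff [ x ∷ t ] ≈ G (x ∷ t)
    oneBlock rewrite es = trans (*-cong (*-identityʳ _) recip1≈1) (*-identityʳ _)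

  module _ (G H : List ℕ → C) where

    AgreeBelow : ℕ → Set ℓ
    AgreeBelow n = ∀ b → IsComp b → length b < n → isEven (sum b) ≡ false → G b ≈ H b

    Π-agree : ∀ n → AgreeBelow n → ∀ bs → allOdd (map sum bs) ≡ true →
      All (λ b → IsComp b × length b < n) bs → Π (map G bs) ≈ Π (map H bs)
    Π-agree n ag [] _ _ = refl
    Π-agree n ag (b ∷ bs) e ((cb , lb) ∷ rest) with isEven (sum b) in eb
    Π-agree n ag (b ∷ bs) () _ | true
    ... | false = *-cong (ag b cb lb eb) (Π-agree n ag bs e rest)

    oddBlockTerm-agree : ∀ n → AgreeBelow n → ∀ wt bs →
      All (λ b → IsComp b × length b < n) bs → oddBlockTerm G wt bs ≈ oddBlockTerm H wt bs
    oddBlockTerm-agree n ag wt bs al with allOdd (map sum bs) in e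
    ... | true = *-congʳ (Π-agree n ag bs e al)
    ... | false = refl

    oddBlockSum-agree : ∀ n → AgreeBelow n → ∀ wt w → IsComp w → length w < n → oddBlockSum G wt w ≈ oddBlockSum H wt w
    oddBlockSum-agree n ag wt w comp lt = Σsplits-cong w agree
      where
      agree : ∀ bs → IsSplit w bs → oddBlockTerm G wt bs ≈ oddBlockTerm H wt bs
      agree bs (P.refl , _) = oddBlockTerm-agree n ag wt bs (All.zip (concat⁻ comp ,
        All.map (λ le → ℕP.<-≤-trans (s≤s le) lt) (length-block≤ bs)))

    multiBlockSum-agree : ∀ wt w → IsComp w → AgreeBelow (length w) →
      Σsplits (multiBlockTerm G wt) w ≈ Σsplits (multiBlockTerm H wt) w
    multiBlockSum-agree wt w comp ag = Σsplits-cong w agree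
      where
      agree : ∀ bs → IsSplit w bs → multiBlockTerm G wt bs ≈ multiBlockTerm H wt bs
      agree [] _ = refl
      agree (b ∷ []) _ = refl
      agree (b ∷ b′ ∷ r) (P.refl , nes) =
        oddBlockTerm-agree (length w) ag wt (b ∷ b′ ∷ r) (All.zip (concat⁻ comp , length-block< b b′ r nes))

    -- In the recursion for α = a ∷ t, G α occurs once (as the one-block split of α) and
    -- every other occurrence of G is at a strictly shorter composition.
    agree-step : SinhRecursion G → SinhRecursion H →
      ∀ α → IsComp α → isEven (sum α) ≡ false → AgreeBelow (length α) → G α ≈ H α
    agree-step recG recH (a ∷ t) comp es ag = +-cancelʳ (rest G) _ _ (begin
      G α + rest G
        ≈⟨ +-assoc _ _ _ ⟨
      G α + multi G + evenIndicator a * S G t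
        ≈⟨ +-congʳ (oddBlockSum-sinh-∷ G a t es) ⟨
      S G α + evenIndicator a * S G t
        ≈⟨ recG a t comp es ⟩
      oddIndicator a * oddBlockSum G coshCoeff t
        ≈⟨ *-congˡ (oddBlockSum-agree (length α) ag coshCoeff t t-comp t-short) ⟩
      oddIndicator a * oddBlockSum H coshCoeff t
        ≈⟨ recH a t comp es ⟨
      S H α + evenIndicator a * S H t
        ≈⟨ +-congʳ (oddBlockSum-sinh-∷ H a t es) ⟩
      H α + multi H + evenIndicator a * S H t
        ≈⟨ +-assoc _ _ _ ⟩
      H α + rest H
        ≈⟨ +-congˡ rest-agree ⟨
      H α + rest G ∎)
      where
      α = a ∷ t
      S : (List ℕ → C) → List ℕ → C
      S K = oddBlockSum K sinhCoeff
      multi rest : (List ℕ → C) → C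
      multi K = Σsplits (multiBlockTerm K sinhCoeff) α
      rest K = multi K + evenIndicator a * S K t
      t-comp : IsComp t
      t-comp = ++⁻ʳ [ a ] comp
      t-short : length t < length α
      t-short = ℕP.≤-refl
      rest-agree : rest G ≈ rest H
      rest-agree = +-cong (multiBlockSum-agree sinhCoeff α comp ag)
                          (*-congˡ (oddBlockSum-agree (length α) ag sinhCoeff t t-comp t-short))

    sinhRecursion-unique : SinhRecursion G → SinhRecursion H →
      ∀ n α → IsComp α → length α < n → isEven (sum α) ≡ false → G α ≈ H α
    sinhRecursion-unique recG recH (suc n) α comp (s≤s le) es =
      agree-step recG recH α comp es (λ b comp′ lt es′ → sinhRecursion-unique recG recH n b comp′ (ℕP.≤-trans lt le) es′)

  gFormula′ : List ℕ → C
  gFormula′ = gFormula F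

  sign-length∸1 : ∀ w → isEven (oddCount w) ≡ false → sign (length w ∸ 1) ≈ sign (evenCount w)
  sign-length∸1 w odd rewrite length≡evenCount+oddCount w with oddCount w
  ... | suc k rewrite ℕP.+-suc (evenCount w) k = sign-+-even (evenCount w) k (not-injective odd)

  gFormula≈signedOdd-artanh : ∀ x t → isEven (sum (x ∷ t)) ≡ false → gFormula′ (x ∷ t) ≈ signedOdd artanh (x ∷ t)
  gFormula≈signedOdd-artanh x t es with lastOdd (x ∷ t) in lo
  ... | false = sym (signedOdd-false artanh (x ∷ t) (P.trans (emptyOrLastOdd-∷ x t) lo))
  ... | true = sym (begin
    signedOdd artanh (x ∷ t)
      ≈⟨ signedOdd-true artanh (x ∷ t) (P.trans (emptyOrLastOdd-∷ x t) lo) ⟩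
    sign (evenCount (x ∷ t)) * artanh (oddCount (x ∷ t))
      ≈⟨ *-cong (sym (sign-length∸1 (x ∷ t) odd)) (reflexive artanh-odd) ⟩
    sign (length (x ∷ t) ∸ 1) * recip (oddCount (x ∷ t)) ∎)
    where
    odd : isEven (oddCount (x ∷ t)) ≡ false
    odd = P.trans (P.sym (isEven-sum≡isEven-oddCount (x ∷ t))) es
    artanh-odd : artanh (oddCount (x ∷ t)) ≡ recip (oddCount (x ∷ t))
    artanh-odd = P.cong (λ b → if b then 0# else recip (oddCount (x ∷ t))) odd

  signedOdd-artanh-even : ∀ w → isEven (sum w) ≡ true → signedOdd artanh w ≈ 0#
  signedOdd-artanh-even w es with emptyOrLastOdd w
  ... | false = refl
  ... | true rewrite P.trans (P.sym (isEven-sum≡isEven-oddCount w)) es = zeroʳ _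

  kronecker : ℕ → ℕ → C
  kronecker r n = if n ℕ.≡ᵇ r then 1# else 0#

  kronecker0-⊛ : ∀ b m → (kronecker 0 ⊛ b) m ≈ b m
  kronecker0-⊛ b zero = *-identityˡ _
  kronecker0-⊛ b (suc m) = trans (+-cong (*-identityˡ _) (Δℕ-zero m (λ i j _ → zeroˡ _))) (+-identityʳ _)

  kronecker1-⊛ : ∀ r n → (kronecker 1 ⊛ kronecker r) n ≈ kronecker (suc r) n
  kronecker1-⊛ r zero = zeroˡ _
  kronecker1-⊛ r (suc m) = trans (+-cong (zeroˡ _) (kronecker0-⊛ (kronecker r) m)) (+-identityˡ _)

  -- Weight kronecker 1 only sees one-block splits, and on one block gFormula is signedOdd artanh.
  oddBlockSum-gFormula-kronecker1 : ∀ w → oddBlockSum gFormula′ (kronecker 1) w ≈ signedOdd artanh w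
  oddBlockSum-gFormula-kronecker1 [] = Σsplits-[] (oddBlockTerm gFormula′ (kronecker 1))
  oddBlockSum-gFormula-kronecker1 (x ∷ t) =
    trans (Σsplits-singleBlock (oddBlockTerm gFormula′ (kronecker 1)) x t twoBlocks≈0) singleBlock
    where
    twoBlocks≈0 : ∀ b b′ r → _ → oddBlockTerm gFormula′ (kronecker 1) (b ∷ b′ ∷ r) ≈ 0#
    twoBlocks≈0 b b′ r _ with allOdd (map sum (b ∷ b′ ∷ r))
    ... | true = zeroʳ _
    ... | false = refl
    singleBlock : oddBlockTerm gFormula′ (kronecker 1) [ x ∷ t ] ≈ signedOdd artanh (x ∷ t)
    singleBlock with isEven (sum (x ∷ t)) in es
    ... | true = sym (signedOdd-artanh-even (x ∷ t) es)
    ... | false = trans (trans (*-identityʳ _) (*-identityʳ _)) (gFormula≈signedOdd-artanh x t es)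

  oddBlockSum-gFormula-kronecker : ∀ r w → oddBlockSum gFormula′ (kronecker r) w ≈ signedOdd (artanh^ r) w
  oddBlockSum-gFormula-kronecker zero [] = Σsplits-[] (oddBlockTerm gFormula′ (kronecker 0))
  oddBlockSum-gFormula-kronecker zero (x ∷ t) = trans (Σsplits-zero (x ∷ t) noBlocks≈0) (sym δ₀-term)
    where
    noBlocks≈0 : ∀ bs → IsSplit (x ∷ t) bs → oddBlockTerm gFormula′ (kronecker 0) bs ≈ 0#
    noBlocks≈0 (b ∷ bs) _ with allOdd (map sum (b ∷ bs))
    ... | true = zeroʳ _
    ... | false = refl
    δ₀-term : signedOdd δ₀ (x ∷ t) ≈ 0#
    δ₀-term with emptyOrLastOdd (x ∷ t) in e
    ... | false = refl
    ... | true with oddCount (x ∷ t) | emptyOrLastOdd⇒1≤oddCount x t e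
    ...   | suc _ | _ = zeroʳ _
  oddBlockSum-gFormula-kronecker (suc r) w = begin
    oddBlockSum gFormula′ (kronecker (suc r)) w
      ≈⟨ oddBlockSum-cong gFormula′ (kronecker1-⊛ r) w ⟨
    oddBlockSum gFormula′ (kronecker 1 ⊛ kronecker r) w
      ≈⟨ oddBlockSum-⋆ gFormula′ (kronecker 1) (kronecker r) w ⟨
    (oddBlockSum gFormula′ (kronecker 1) ⋆ oddBlockSum gFormula′ (kronecker r)) w
      ≈⟨ ⋆-cong w (λ u v _ → oddBlockSum-gFormula-kronecker1 u) (λ u v _ → oddBlockSum-gFormula-kronecker r v) ⟩
    (signedOdd artanh ⋆ signedOdd (artanh^ r)) w
      ≈⟨ signedOdd-⋆ artanh (artanh^ r) w ⟩
    signedOdd (artanh^ (suc r)) w ∎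

  sumUpTo-kronecker : ∀ M (wt : ℕ → C) l → l ≤ M → sumUpTo M (λ r → wt r * kronecker r l) ≈ wt l
  sumUpTo-kronecker zero wt zero _ = *-identityʳ _
  sumUpTo-kronecker (suc M) wt zero _ = trans (+-cong (*-identityʳ _) (sumUpTo-zero M (λ r → zeroʳ _))) (+-identityʳ _)
  sumUpTo-kronecker (suc M) wt (suc l) (s≤s le) = trans (+-cong (zeroʳ _) (sumUpTo-kronecker M (λ r → wt (suc r)) l le)) (+-identityˡ _)

  Σsplits-sumUpTo : ∀ M (k : ℕ → List (List ℕ) → C) w →
    Σsplits (λ bs → sumUpTo M (λ r → k r bs)) w ≈ sumUpTo M (λ r → Σsplits (k r) w)
  Σsplits-sumUpTo zero k w = refl
  Σsplits-sumUpTo (suc M) k w = trans (Σsplits-+ _ _ w) (+-congˡ (Σsplits-sumUpTo M (λ r → k (suc r)) w))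

  oddBlockSum-expand : ∀ g′ wt M w → length w ≤ M → oddBlockSum g′ wt w ≈ sumUpTo M (λ r → wt r * oddBlockSum g′ (kronecker r) w)
  oddBlockSum-expand g′ wt M w le = trans (Σsplits-cong w per) (trans (Σsplits-sumUpTo M _ w) (sumUpTo-cong M (λ r → Σsplits-* (wt r) _ w)))
    where
    per : ∀ bs → IsSplit w bs → oddBlockTerm g′ wt bs ≈ sumUpTo M (λ r → wt r * oddBlockTerm g′ (kronecker r) bs)
    per bs (ecat , nes) with allOdd (map sum bs)
    ... | false = sym (sumUpTo-zero M (λ r → zeroʳ _))
    ... | true = begin
      Π (map g′ bs) * wt (length bs)
        ≈⟨ *-congˡ (sumUpTo-kronecker M wt (length bs) #bs≤M) ⟨
      Π (map g′ bs) * sumUpTo M (λ r → wt r * kronecker r (length bs))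
        ≈⟨ sumUpTo-* M _ _ ⟨
      sumUpTo M (λ r → Π (map g′ bs) * (wt r * kronecker r (length bs)))
        ≈⟨ sumUpTo-cong M (λ r → x*yz≈y*xz _ _ _) ⟩
      sumUpTo M (λ r → wt r * (Π (map g′ bs) * kronecker r (length bs))) ∎
      where
      #bs≤M : length bs ≤ M
      #bs≤M = ℕP.≤-trans (#blocks≤length bs nes) (P.subst (λ m → length m ≤ M) (P.sym ecat) le)

  signedOdd-sumUpTo : ∀ M (a : ℕ → C) (f : ℕ → ℕ → C) w →
    sumUpTo M (λ r → a r * signedOdd (f r) w) ≈ signedOdd (λ n → sumUpTo M (λ r → a r * f r n)) w
  signedOdd-sumUpTo M a f w with emptyOrLastOdd w
  ... | true = trans (sumUpTo-cong M (λ r → x*yz≈y*xz _ _ _)) (sumUpTo-* M _ _)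
  ... | false = sumUpTo-zero M (λ r → zeroʳ _)

  oddBlockSum-gFormula : ∀ wt M w → length w ≤ M →
    oddBlockSum gFormula′ wt w ≈ signedOdd (λ n → sumUpTo M (λ r → wt r * artanh^ r n)) w
  oddBlockSum-gFormula wt M w le = trans (oddBlockSum-expand gFormula′ wt M w le)
    (trans (sumUpTo-cong M (λ r → *-congˡ (oddBlockSum-gFormula-kronecker r w))) (signedOdd-sumUpTo M wt artanh^ w))

  gFormula-sinhRecursion : SinhRecursion gFormula′
  gFormula-sinhRecursion a t _ es with isEven a in ea
  ... | false = begin
    S (a ∷ t) + 0# * S t
      ≈⟨ trans (+-congˡ (zeroˡ _)) (+-identityʳ _) ⟩
    S (a ∷ t)
      ≈⟨ oddBlockSum-gFormula sinhCoeff M (a ∷ t) ℕP.≤-refl ⟩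
    signedOdd (sinhArtanh M) (a ∷ t)
      ≈⟨ signedOdd-odd∷ (sinhArtanh M) a ea t ⟩
    signedOdd (sinhArtanh M ∘ suc) t
      ≈⟨ signedOdd-cong (sinhArtanh M ∘ suc) (coshArtanh M) t (sinhArtanh-suc≈coshArtanh M (oddCount t) (s≤s (oddCount≤length t))) ⟩
    signedOdd (coshArtanh M) t
      ≈⟨ oddBlockSum-gFormula coshCoeff M t (ℕP.n≤1+n _) ⟨
    Ch t
      ≈⟨ *-identityˡ _ ⟨
    1# * Ch t ∎
    where
    M = length (a ∷ t)
    S Ch : List ℕ → C
    S = oddBlockSum gFormula′ sinhCoeff
    Ch = oddBlockSum gFormula′ coshCoeff
  gFormula-sinhRecursion a [] _ es | true with () ← P.trans (P.sym es) (P.trans (P.cong isEven (ℕP.+-identityʳ a)) ea)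
  gFormula-sinhRecursion a (y ∷ l) _ es | true = begin
    S (a ∷ y ∷ l) + 1# * S (y ∷ l)
      ≈⟨ +-cong (oddBlockSum-gFormula sinhCoeff M (a ∷ y ∷ l) ℕP.≤-refl)
                (trans (*-identityˡ _) (oddBlockSum-gFormula sinhCoeff M (y ∷ l) (ℕP.n≤1+n _))) ⟩
    signedOdd (sinhArtanh M) (a ∷ y ∷ l) + signedOdd (sinhArtanh M) (y ∷ l)
      ≈⟨ +-congʳ (signedOdd-even∷ (sinhArtanh M) a ea y l) ⟩
    - signedOdd (sinhArtanh M) (y ∷ l) + signedOdd (sinhArtanh M) (y ∷ l)
      ≈⟨ -‿inverseˡ _ ⟩
    0#
      ≈⟨ zeroˡ _ ⟨
    0# * oddBlockSum gFormula′ coshCoeff (y ∷ l) ∎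
    where
    M = length (a ∷ y ∷ l)
    S : List ℕ → C
    S = oddBlockSum gFormula′ sinhCoeff

  invFact invFact-suc : ℕ → C
  invFact n = recip (n !)
  invFact-suc n = recip (suc n !)

  ifEvenSum : List ℕ → C → C → C
  ifEvenSum b p q = if isEven (sum b) then p else q

  atMostOnePart : List ℕ → C
  atMostOnePart [] = 1#
  atMostOnePart (x ∷ []) = 1#
  atMostOnePart (x ∷ y ∷ l) = 0#

  module _ (fE : List ℕ → Carrier) where

    f : List ℕ → C
    f = fFun F fE

    f-allEven : ∀ π → allEven π ≡ true → f π ≈ fE π * recip 1
    f-allEven π e = reflexive (P.trans
        (P.cong (λ t → if t then fE (restrictE π) * recip (length (restrictO π) !) else 0#)
                (==-true (P.sym (P.trans (P.cong₂ _++_ (restrictE-allEven π e) (restrictO-allEven π e)) (++-identityʳ π)))))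
        (P.cong₂ (λ a b → fE a * recip (length b !)) (restrictE-allEven π e) (restrictO-allEven π e)))

    f-allEven++odd∷ : ∀ π s β → allEven π ≡ true → isEven s ≡ false →
      f (π ++ s ∷ β) ≈ (if allOdd β then fE π * recip (suc (length β) !) else 0#)
    f-allEven++odd∷ π s β eπ es = byAllOdd (allOdd β) P.refl
      where
      α = π ++ s ∷ β
      rEα : restrictE α ≡ π ++ restrictE β
      rEα = P.trans (restrictE-allEven-++ π (s ∷ β) eπ)
                    (P.cong (π ++_) (P.cong (λ t → if t then s ∷ restrictE β else restrictE β) es))
      rOα : restrictO α ≡ s ∷ restrictO β
      rOα = P.trans (restrictO-allEven-++ π (s ∷ β) eπ)
                    (P.cong (λ t → if not t then s ∷ restrictO β else restrictO β) es)
      byAllOdd : ∀ t → allOdd β ≡ t → f α ≈ (if t then fE π * recip (suc (length β) !) else 0#)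
      byAllOdd true eβ = reflexive (P.trans
        (P.cong (λ t → if t then fE (restrictE α) * recip (length (restrictO α) !) else 0#)
          (==-true (P.sym (P.cong₂ _++_ eE eO))))
        (P.cong₂ (λ a b → fE a * recip (length b !)) eE eO))
        where
        eE : restrictE α ≡ π
        eE = P.trans rEα (P.trans (P.cong (π ++_) (restrictE-allOdd β eβ)) (++-identityʳ π))
        eO : restrictO α ≡ s ∷ β
        eO = P.trans rOα (P.cong (s ∷_) (restrictO-allOdd β eβ))
      byAllOdd false eβ =
        reflexive (P.cong (λ t → if t then fE (restrictE α) * recip (length (restrictO α) !) else 0#) (==-false notSorted))
        where
        -- an even part of β would have to come before s
        notSorted : α ≢ (restrictE α ++ restrictO α)
        notSorted h = contra (restrictE β) P.refl
          where
          h′ : s ∷ β ≡ restrictE β ++ s ∷ restrictO β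
          h′ = ++-cancelˡ π _ _ (P.trans h (P.trans (P.cong₂ _++_ rEα rOα) (++-assoc π (restrictE β) (s ∷ restrictO β))))
          contra : ∀ l → restrictE β ≡ l → ⊥
          contra [] el with () ← P.trans (P.sym (restrictE≡[]⇒allOdd β el)) eβ
          contra (e₀ ∷ r) el with () ← P.trans (P.sym es)
            (P.trans (P.cong isEven (∷-injectiveˡ (P.trans h′ (P.cong (_++ s ∷ restrictO β) el)))) (restrictE-head-even β e₀ r el))

    module _ (g : List ℕ → Carrier) where

      evenBlockTerm : List ℕ → List (List ℕ) → C
      evenBlockTerm π bs = if allEven (map sum bs) then Π (map g bs) * fE (π ++ map sum bs) else 0#

      evenBlockSum : List ℕ → List ℕ → C
      evenBlockSum π = Σsplits (evenBlockTerm π)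

      evenBlockTerm-even∷ : ∀ π b bs → isEven (sum b) ≡ true →
        evenBlockTerm π (b ∷ bs) ≈ g b * evenBlockTerm (π ++ [ sum b ]) bs
      evenBlockTerm-even∷ π b bs eb rewrite eb | ++-assoc π [ sum b ] (map sum bs) with allEven (map sum bs)
      ... | true = *-assoc _ _ _
      ... | false = sym (zeroʳ _)

      evenBlockTerm-odd∷ : ∀ π b bs → isEven (sum b) ≡ false → evenBlockTerm π (b ∷ bs) ≈ 0#
      evenBlockTerm-odd∷ π b bs eb rewrite eb = refl

      evenBlockSum-odd : ∀ π u → isEven (sum u) ≡ false → evenBlockSum π u ≈ 0#
      evenBlockSum-odd π u eu = Σsplits-zero u vanishes
        where
        vanishes : ∀ bs → IsSplit u bs → evenBlockTerm π bs ≈ 0#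
        vanishes bs (ecat , _) with allEven (map sum bs) in e
        ... | false = refl
        ... | true with () ← P.trans (P.sym eu) (P.trans (P.cong isEven (P.trans (P.sym (P.cong sum ecat)) (sum-concat bs)))
                                                           (allEven⇒isEven-sum (map sum bs) e))

      fBlockTerm : List ℕ → List (List ℕ) → C
      fBlockTerm π bs = Π (map g bs) * f (π ++ map sum bs)

      fBlockSum : List ℕ → List ℕ → C
      fBlockSum π = Σsplits (fBlockTerm π)

      expSum expSum-suc : List ℕ → C
      expSum = oddBlockSum g invFact
      expSum-suc = oddBlockSum g invFact-suc

      fBlockTerm-even∷ : ∀ π b bs → isEven (sum b) ≡ true → fBlockTerm π (b ∷ bs) ≈ g b * fBlockTerm (π ++ [ sum b ]) bs
      fBlockTerm-even∷ π b bs _ rewrite ++-assoc π [ sum b ] (map sum bs) = *-assoc _ _ _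

      fBlockTerm-odd∷ : ∀ π b bs → allEven π ≡ true → isEven (sum b) ≡ false →
        fBlockTerm π (b ∷ bs) ≈ g b * (fE π * oddBlockTerm g invFact-suc bs)
      fBlockTerm-odd∷ π b bs eπ eb =
        trans (*-assoc _ _ _) (*-congˡ (trans (*-congˡ (f-allEven++odd∷ π (sum b) (map sum bs) eπ eb)) rest))
        where
        rest : Π (map g bs) * (if allOdd (map sum bs) then fE π * recip (suc (length (map sum bs)) !) else 0#)
                 ≈ fE π * oddBlockTerm g invFact-suc bs
        rest rewrite length-map sum bs with allOdd (map sum bs)
        ... | true = x*yz≈y*xz _ _ _
        ... | false = trans (zeroʳ _) (sym (zeroʳ _))

      expSum-∷ : ∀ x t → expSum (x ∷ t) ≈ Δ (λ u v → ifEvenSum (x ∷ u) 0# (g (x ∷ u) * expSum-suc v)) t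
      expSum-∷ x t = trans (Σsplits-firstBlock (oddBlockTerm g invFact) x t) (Δ-cong′ t step)
        where
        step : ∀ u v → Σsplits (λ bs → oddBlockTerm g invFact ((x ∷ u) ∷ bs)) v ≈ ifEvenSum (x ∷ u) 0# (g (x ∷ u) * expSum-suc v)
        step u v = byParity (isEven (sum (x ∷ u))) P.refl
          where
          byParity : ∀ p → isEven (sum (x ∷ u)) ≡ p →
            Σsplits (λ bs → oddBlockTerm g invFact ((x ∷ u) ∷ bs)) v ≈ (if p then 0# else g (x ∷ u) * expSum-suc v)
          byParity true eb = Σsplits-zero v (λ bs _ → oddBlockTerm-even∷ g invFact (x ∷ u) bs eb)
          byParity false eb = trans (Σsplits-cong′ v (λ bs → oddBlockTerm-odd∷ g invFact (x ∷ u) bs eb)) (Σsplits-* _ _ v)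

      evenBlockSum-∷ : ∀ π x t →
        evenBlockSum π (x ∷ t) ≈ Δ (λ u v → ifEvenSum (x ∷ u) (g (x ∷ u) * evenBlockSum (π ++ [ sum (x ∷ u) ]) v) 0#) t
      evenBlockSum-∷ π x t = trans (Σsplits-firstBlock (evenBlockTerm π) x t) (Δ-cong′ t step)
        where
        step : ∀ u v → Σsplits (λ bs → evenBlockTerm π ((x ∷ u) ∷ bs)) v
                         ≈ ifEvenSum (x ∷ u) (g (x ∷ u) * evenBlockSum (π ++ [ sum (x ∷ u) ]) v) 0#
        step u v = byParity (isEven (sum (x ∷ u))) P.refl
          where
          byParity : ∀ p → isEven (sum (x ∷ u)) ≡ p → Σsplits (λ bs → evenBlockTerm π ((x ∷ u) ∷ bs)) v
                                                          ≈ (if p then g (x ∷ u) * evenBlockSum (π ++ [ sum (x ∷ u) ]) v else 0#)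
          byParity true eb = trans (Σsplits-cong′ v (λ bs → evenBlockTerm-even∷ π (x ∷ u) bs eb)) (Σsplits-* _ _ v)
          byParity false eb = Σsplits-zero v (λ bs _ → evenBlockTerm-odd∷ π (x ∷ u) bs eb)

      evenBlockSum⋆expSum-∷ : ∀ π x t → Δ (λ u v → evenBlockSum π (x ∷ u) * expSum v) t
        ≈ Δ (λ u w → ifEvenSum (x ∷ u) (g (x ∷ u) * (evenBlockSum (π ++ [ sum (x ∷ u) ]) ⋆ expSum) w) 0#) t
      evenBlockSum⋆expSum-∷ π x t = begin
        Δ (λ u v → evenBlockSum π (x ∷ u) * expSum v) t
          ≈⟨ Δ-cong′ t (λ u v → *-congʳ (evenBlockSum-∷ π x u)) ⟩
        Δ (λ u v → Δ K u * expSum v) t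
          ≈⟨ Δ-cong′ t (λ u v → Δ-*ʳ _ K u) ⟨
        Δ (λ u v → Δ (λ u₁ v₁ → K u₁ v₁ * expSum v) u) t
          ≈⟨ Δ-assoc (λ u₁ v₁ v → K u₁ v₁ * expSum v) t ⟩
        Δ (λ u w → Δ (λ v₁ v → K u v₁ * expSum v) w) t
          ≈⟨ Δ-cong′ t pull ⟩
        Δ (λ u w → ifEvenSum (x ∷ u) (g (x ∷ u) * (evenBlockSum (π ++ [ sum (x ∷ u) ]) ⋆ expSum) w) 0#) t ∎
        where
        K : List ℕ → List ℕ → C
        K u v = ifEvenSum (x ∷ u) (g (x ∷ u) * evenBlockSum (π ++ [ sum (x ∷ u) ]) v) 0#
        pull : ∀ u w → Δ (λ v₁ v → K u v₁ * expSum v) w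
                         ≈ ifEvenSum (x ∷ u) (g (x ∷ u) * (evenBlockSum (π ++ [ sum (x ∷ u) ]) ⋆ expSum) w) 0#
        pull u w with isEven (sum (x ∷ u))
        ... | true = trans (Δ-cong′ w (λ v₁ v → *-assoc _ _ _)) (Δ-*ˡ _ _ w)
        ... | false = Δ-zero w (λ v₁ v _ → zeroˡ _)

      -- Splitting off the first block x ∷ u of a split of x ∷ t: if its sum is even it is absorbed
      -- into the prefix π, otherwise f forces all remaining block sums to be odd.
      fBlockSum≈evenBlockSum⋆expSum : ∀ n α → length α ≤ n → ∀ π → allEven π ≡ true →
        fBlockSum π α ≈ (evenBlockSum π ⋆ expSum) α
      fBlockSum≈evenBlockSum⋆expSum n [] le π eπ = begin
        fBlockSum π []
          ≈⟨ Σsplits-[] (fBlockTerm π) ⟩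
        1# * f (π ++ [])
          ≈⟨ *-congˡ (f-allEven (π ++ []) (P.subst (λ m → allEven m ≡ true) (P.sym (++-identityʳ π)) eπ)) ⟩
        1# * (fE (π ++ []) * recip 1)
          ≈⟨ trans (*-identityˡ _) (sym (*-cong (*-identityˡ _) (*-identityˡ _))) ⟩
        evenBlockTerm π [] * oddBlockTerm g invFact []
          ≈⟨ *-cong (Σsplits-[] (evenBlockTerm π)) (Σsplits-[] (oddBlockTerm g invFact)) ⟨
        (evenBlockSum π ⋆ expSum) [] ∎
      fBlockSum≈evenBlockSum⋆expSum (suc n) (x ∷ t) (s≤s le) π eπ = begin
        fBlockSum π (x ∷ t)
          ≈⟨ Σsplits-firstBlock (fBlockTerm π) x t ⟩
        Δ (λ u v → Σsplits (λ bs → fBlockTerm π ((x ∷ u) ∷ bs)) v) t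
          ≈⟨ Δ-cong t firstBlock ⟩
        Δ (λ u v → fE π * Odd u v + Even u v) t
          ≈⟨ Δ-+ _ _ t ⟩
        Δ (λ u v → fE π * Odd u v) t + Δ Even t
          ≈⟨ +-congʳ (Δ-*ˡ (fE π) Odd t) ⟩
        fE π * Δ Odd t + Δ Even t
          ≈⟨ +-cong (*-cong evenBlockSum-[] (expSum-∷ x t)) (evenBlockSum⋆expSum-∷ π x t) ⟨
        evenBlockSum π [] * expSum (x ∷ t) + Δ (λ u v → evenBlockSum π (x ∷ u) * expSum v) t
          ≈⟨ refl ⟩
        (evenBlockSum π ⋆ expSum) (x ∷ t) ∎
        where
        Odd Even : List ℕ → List ℕ → C
        Odd u v = ifEvenSum (x ∷ u) 0# (g (x ∷ u) * expSum-suc v)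
        Even u v = ifEvenSum (x ∷ u) (g (x ∷ u) * (evenBlockSum (π ++ [ sum (x ∷ u) ]) ⋆ expSum) v) 0#
        evenBlockSum-[] : evenBlockSum π [] ≈ fE π
        evenBlockSum-[] = trans (Σsplits-[] (evenBlockTerm π)) (trans (*-identityˡ _) (reflexive (P.cong fE (++-identityʳ π))))
        firstBlock : ∀ u v → u ++ v ≡ t → Σsplits (λ bs → fBlockTerm π ((x ∷ u) ∷ bs)) v ≈ fE π * Odd u v + Even u v
        firstBlock u v e = byParity (isEven (sum (x ∷ u))) P.refl
          where
          byParity : ∀ p → isEven (sum (x ∷ u)) ≡ p → Σsplits (λ bs → fBlockTerm π ((x ∷ u) ∷ bs)) v
            ≈ fE π * (if p then 0# else g (x ∷ u) * expSum-suc v)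
              + (if p then g (x ∷ u) * (evenBlockSum (π ++ [ sum (x ∷ u) ]) ⋆ expSum) v else 0#)
          byParity true eb = begin
            Σsplits (λ bs → fBlockTerm π ((x ∷ u) ∷ bs)) v
              ≈⟨ Σsplits-cong′ v (λ bs → fBlockTerm-even∷ π (x ∷ u) bs eb) ⟩
            Σsplits (λ bs → g (x ∷ u) * fBlockTerm (π ++ [ sum (x ∷ u) ]) bs) v
              ≈⟨ Σsplits-* _ _ v ⟩
            g (x ∷ u) * fBlockSum (π ++ [ sum (x ∷ u) ]) v
              ≈⟨ *-congˡ (fBlockSum≈evenBlockSum⋆expSum n v (ℕP.≤-trans (length-suffix≤ u v t e) le) _ (allEven-∷ʳ π _ eπ eb)) ⟩
            g (x ∷ u) * (evenBlockSum (π ++ [ sum (x ∷ u) ]) ⋆ expSum) v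
              ≈⟨ trans (+-congʳ (zeroʳ _)) (+-identityˡ _) ⟨
            fE π * 0# + g (x ∷ u) * (evenBlockSum (π ++ [ sum (x ∷ u) ]) ⋆ expSum) v ∎
          byParity false eb = begin
            Σsplits (λ bs → fBlockTerm π ((x ∷ u) ∷ bs)) v
              ≈⟨ Σsplits-cong′ v (λ bs → fBlockTerm-odd∷ π (x ∷ u) bs eπ eb) ⟩
            Σsplits (λ bs → g (x ∷ u) * (fE π * oddBlockTerm g invFact-suc bs)) v
              ≈⟨ trans (Σsplits-* _ _ v) (*-congˡ (Σsplits-* _ _ v)) ⟩
            g (x ∷ u) * (fE π * expSum-suc v)
              ≈⟨ trans (+-identityʳ _) (x*yz≈y*xz _ _ _) ⟨
            fE π * (g (x ∷ u) * expSum-suc v) + 0# ∎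

      fCoeff : List ℕ → List ℕ → C
      fCoeff γ β = sumOver (λ bs′ → if map sum bs′ == γ then Π (map f bs′) else 0#) (splits β)

      coeffMX≡ : ∀ α γ → coeffMX F f g α γ ≡ sumOver (λ bs → Π (map g bs) * fCoeff γ (map sum bs)) (splits α)
      coeffMX≡ α γ = sumOver-map-map _ _ _
        (λ bs → P.cong (Π (map g bs) *_) (sumOver-map-map _ _ _ (λ _ → P.refl) (splits (map sum bs)))) (splits α)

      fCoeff-single : ∀ α bs → NonEmpty α → IsSplit α bs → fCoeff [ sum α ] (map sum bs) ≈ f (map sum bs)
      fCoeff-single α [] ne (ecat , _) = ⊥-elim (P.subst NonEmpty (P.sym ecat) ne)
      fCoeff-single α (b ∷ bs) ne (ecat , _) = begin
          fCoeff [ sum α ] (map sum (b ∷ bs))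
            ≈⟨ reflexive (P.cong (sumOver h) (splits≡splits′ (map sum (b ∷ bs)))) ⟩
          Σsplits h (sum b ∷ map sum bs)
            ≈⟨ Σsplits-singleBlock h (sum b) (map sum bs) (λ b1 b2 r _ → reflexive (P.cong (λ t → if t then Π (map f (b1 ∷ b2 ∷ r)) else 0#) (==-false {map sum (b1 ∷ b2 ∷ r)} {[ sum α ]} (λ ())))) ⟩
          h [ β ]
            ≈⟨ reflexive (P.cong (λ t → if t then Π (map f [ β ]) else 0#) (==-true (P.cong [_] sβ))) ⟩
          f β * 1#
            ≈⟨ *-identityʳ _ ⟩
          f β ∎
        where
        β = map sum (b ∷ bs)
        h : List (List ℕ) → C
        h bs′ = if map sum bs′ == [ sum α ] then Π (map f bs′) else 0#
        sβ : sum β ≡ sum α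
        sβ = P.trans (P.sym (sum-concat (b ∷ bs))) (P.cong sum ecat)

      coeffMX-single≈fBlockSum : ∀ α → NonEmpty α → coeffMX F f g α [ sum α ] ≈ fBlockSum [] α
      coeffMX-single≈fBlockSum α ne = trans (reflexive (coeffMX≡ α [ sum α ])) (trans (reflexive (P.cong (sumOver _) (splits≡splits′ α)))
          (Σsplits-cong α (λ bs gd → *-congˡ (fCoeff-single α bs ne gd))))

      module _ (sc : IsShuffleCharacter F fE) (invX : InvertsX F fE g) where

        -- Only the coefficient of M_(|α|) in the inversion identity is needed.
        evenBlockSum⋆expSum≈atMostOnePart : ∀ α → IsComp α → (evenBlockSum [] ⋆ expSum) α ≈ atMostOnePart α
        evenBlockSum⋆expSum≈atMostOnePart [] comp = begin
            (evenBlockSum [] ⋆ expSum) [] ≈⟨ sym (fBlockSum≈evenBlockSum⋆expSum 0 [] z≤n [] P.refl) ⟩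
            fBlockSum [] [] ≈⟨ Σsplits-[] (fBlockTerm []) ⟩
            1# * f [] ≈⟨ trans (*-identityˡ _) (f-allEven [] P.refl) ⟩
            fE [] * recip 1 ≈⟨ *-cong (proj₁ sc) recip1≈1 ⟩
            1# * 1# ≈⟨ *-identityʳ _ ⟩
            1# ∎
        evenBlockSum⋆expSum≈atMostOnePart (x ∷ t) comp = begin
            (evenBlockSum [] ⋆ expSum) (x ∷ t)
              ≈⟨ sym (fBlockSum≈evenBlockSum⋆expSum _ (x ∷ t) ℕP.≤-refl [] P.refl) ⟩
            fBlockSum [] (x ∷ t)
              ≈⟨ sym (coeffMX-single≈fBlockSum (x ∷ t) tt) ⟩
            coeffMX F f g (x ∷ t) [ sum (x ∷ t) ]
              ≈⟨ invX (x ∷ t) comp (λ ()) [ sum (x ∷ t) ] ⟩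
            (if (x ∷ t) == [ sum (x ∷ t) ] then 1# else 0#)
              ≈⟨ coeff-single t ⟩
            atMostOnePart (x ∷ t) ∎
          where
          coeff-single : ∀ t → (if (x ∷ t) == [ sum (x ∷ t) ] then 1# else 0#) ≈ atMostOnePart (x ∷ t)
          coeff-single [] = reflexive (P.cong (λ b → if b then 1# else 0#) (==-true (P.cong [_] (P.sym (ℕP.+-identityʳ x)))))
          coeff-single (y ∷ l) = reflexive (P.cong (λ b → if b then 1# else 0#) (==-false {x ∷ y ∷ l} {[ sum (x ∷ y ∷ l) ]} (λ ())))

        sinhSum coshSum : List ℕ → C
        sinhSum = oddBlockSum g sinhCoeff
        coshSum = oddBlockSum g coshCoeff

        expSum≈coshSum+sinhSum : ∀ w → expSum w ≈ coshSum w + sinhSum w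
        expSum≈coshSum+sinhSum w =
          trans (oddBlockSum-cong g split w) (trans (oddBlockSum-linear g 1# coshCoeff sinhCoeff w) (+-congʳ (*-identityˡ _)))
          where
          split : ∀ n → invFact n ≈ 1# * coshCoeff n + sinhCoeff n
          split n with isEven n
          ... | true = sym (trans (+-congʳ (*-identityˡ _)) (+-identityʳ _))
          ... | false = sym (trans (+-congʳ (zeroʳ _)) (+-identityˡ _))

        -- The even-sum blocks of evenBlockSum do not change the parity of what is left.
        evenBlockSum⋆oddBlockSum-vanish : ∀ wt w → (∀ n → isEven n ≡ isEven (sum w) → wt n ≈ 0#) →
          (evenBlockSum [] ⋆ oddBlockSum g wt) w ≈ 0#
        evenBlockSum⋆oddBlockSum-vanish wt w wt≈0 = Δ-zero w vanishes
          where
          vanishes : ∀ u v → u ++ v ≡ w → evenBlockSum [] u * oddBlockSum g wt v ≈ 0#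
          vanishes u v e with isEven (sum u) in eu
          ... | false = trans (*-congʳ (evenBlockSum-odd [] u eu)) (zeroˡ _)
          ... | true = trans (*-congˡ (oddBlockSum-parity g wt v (λ n en → wt≈0 n (P.trans en v~w)))) (zeroʳ _)
            where
            v~w : isEven (sum v) ≡ isEven (sum w)
            v~w = P.sym (P.trans (isEven-sum-++ u v w e) (P.cong (λ b → if b then isEven (sum v) else not (isEven (sum v))) eu))

        evenBlockSum⋆sinhSum-even : ∀ w → isEven (sum w) ≡ true → (evenBlockSum [] ⋆ sinhSum) w ≈ 0#
        evenBlockSum⋆sinhSum-even w ew = evenBlockSum⋆oddBlockSum-vanish sinhCoeff w
          (λ n en → reflexive (P.cong (λ b → if b then 0# else recip (n !)) (P.trans en ew)))

        evenBlockSum⋆coshSum-odd : ∀ w → isEven (sum w) ≡ false → (evenBlockSum [] ⋆ coshSum) w ≈ 0#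
        evenBlockSum⋆coshSum-odd w ew = evenBlockSum⋆oddBlockSum-vanish coshCoeff w
          (λ n en → reflexive (P.cong (λ b → if b then recip (n !) else 0#) (P.trans en ew)))

        evenBlockSum⋆[coshSum+sinhSum] : ∀ w → IsComp w →
          (evenBlockSum [] ⋆ coshSum) w + (evenBlockSum [] ⋆ sinhSum) w ≈ atMostOnePart w
        evenBlockSum⋆[coshSum+sinhSum] w comp = begin
          (evenBlockSum [] ⋆ coshSum) w + (evenBlockSum [] ⋆ sinhSum) w
            ≈⟨ ⋆-distribˡ-+ _ _ _ w ⟨
          (evenBlockSum [] ⋆ (λ v → coshSum v + sinhSum v)) w
            ≈⟨ ⋆-cong w (λ _ _ _ → refl) (λ u v _ → expSum≈coshSum+sinhSum v) ⟨
          (evenBlockSum [] ⋆ expSum) w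
            ≈⟨ evenBlockSum⋆expSum≈atMostOnePart w comp ⟩
          atMostOnePart w ∎

        atMostOnePart-even atMostOnePart-odd : List ℕ → C
        atMostOnePart-even w = if isEven (sum w) then atMostOnePart w else 0#
        atMostOnePart-odd w = if isEven (sum w) then 0# else atMostOnePart w

        evenBlockSum⋆coshSum : ∀ w → IsComp w → (evenBlockSum [] ⋆ coshSum) w ≈ atMostOnePart-even w
        evenBlockSum⋆coshSum w comp with isEven (sum w) in ew
        ... | true = trans (sym (trans (+-congˡ (evenBlockSum⋆sinhSum-even w ew)) (+-identityʳ _)))
                           (evenBlockSum⋆[coshSum+sinhSum] w comp)
        ... | false = evenBlockSum⋆coshSum-odd w ew

        evenBlockSum⋆sinhSum : ∀ w → IsComp w → (evenBlockSum [] ⋆ sinhSum) w ≈ atMostOnePart-odd w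
        evenBlockSum⋆sinhSum w comp with isEven (sum w) in ew
        ... | true = evenBlockSum⋆sinhSum-even w ew
        ... | false = trans (sym (trans (+-congʳ (evenBlockSum⋆coshSum-odd w ew)) (+-identityˡ _)))
                            (evenBlockSum⋆[coshSum+sinhSum] w comp)

        -- evenBlockSum [] is a common ⋆-factor which the commutativity of ⊛ lets us move across.
        atMostOnePart-even⋆sinh≈atMostOnePart-odd⋆cosh : ∀ α → IsComp α →
          (atMostOnePart-even ⋆ sinhSum) α ≈ (atMostOnePart-odd ⋆ coshSum) α
        atMostOnePart-even⋆sinh≈atMostOnePart-odd⋆cosh α comp = begin
            (atMostOnePart-even ⋆ sinhSum) α
              ≈⟨ ⋆-cong α (λ u v e → evenBlockSum⋆coshSum u (prefix u v e)) (λ _ _ _ → refl) ⟨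
            (evenBlockSum [] ⋆ coshSum ⋆ sinhSum) α
              ≈⟨ ⋆-assoc _ _ _ α ⟩
            (evenBlockSum [] ⋆ (coshSum ⋆ sinhSum)) α
              ≈⟨ ⋆-cong α (λ _ _ _ → refl) (λ u v _ → coshSum⋆sinhSum≈sinhSum⋆coshSum v) ⟩
            (evenBlockSum [] ⋆ (sinhSum ⋆ coshSum)) α
              ≈⟨ ⋆-assoc _ _ _ α ⟨
            (evenBlockSum [] ⋆ sinhSum ⋆ coshSum) α
              ≈⟨ ⋆-cong α (λ u v e → evenBlockSum⋆sinhSum u (prefix u v e)) (λ _ _ _ → refl) ⟩
            (atMostOnePart-odd ⋆ coshSum) α ∎
          where
          prefix : ∀ u v → u ++ v ≡ α → IsComp u
          prefix u v e = ++⁻ˡ u (P.subst IsComp (P.sym e) comp)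
          coshSum⋆sinhSum≈sinhSum⋆coshSum : ∀ v → (coshSum ⋆ sinhSum) v ≈ (sinhSum ⋆ coshSum) v
          coshSum⋆sinhSum≈sinhSum⋆coshSum v = begin
            (coshSum ⋆ sinhSum) v                  ≈⟨ oddBlockSum-⋆ g coshCoeff sinhCoeff v ⟩
            oddBlockSum g (coshCoeff ⊛ sinhCoeff) v ≈⟨ oddBlockSum-cong g (⊛-comm coshCoeff sinhCoeff) v ⟩
            oddBlockSum g (sinhCoeff ⊛ coshCoeff) v ≈⟨ oddBlockSum-⋆ g sinhCoeff coshCoeff v ⟨
            (sinhSum ⋆ coshSum) v                  ∎

        sinhRecursion : SinhRecursion g
        sinhRecursion a t comp _ = begin
            sinhSum (a ∷ t) + evenIndicator a * sinhSum t
              ≈⟨ +-cong (*-identityˡ _) (*-congʳ (reflexive (P.cong evenIndicator (ℕP.+-identityʳ a)))) ⟨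
            1# * sinhSum (a ∷ t) + atMostOnePart-even [ a ] * sinhSum t
              ≈⟨ +-congˡ (Δ-head t (λ x u v → trans (*-congʳ (reflexive (if-eta (isEven (sum (a ∷ x ∷ u)))))) (zeroˡ _))) ⟨
            (atMostOnePart-even ⋆ sinhSum) (a ∷ t)
              ≈⟨ atMostOnePart-even⋆sinh≈atMostOnePart-odd⋆cosh (a ∷ t) comp ⟩
            (atMostOnePart-odd ⋆ coshSum) (a ∷ t)
              ≈⟨ +-congˡ (Δ-head t (λ x u v → trans (*-congʳ (reflexive (if-eta (isEven (sum (a ∷ x ∷ u)))))) (zeroˡ _))) ⟩
            0# * coshSum (a ∷ t) + atMostOnePart-odd [ a ] * coshSum t
              ≈⟨ +-cong (zeroˡ _) (*-congʳ (reflexive (P.cong oddIndicator (ℕP.+-identityʳ a)))) ⟩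
            0# + oddIndicator a * coshSum t
              ≈⟨ +-identityˡ _ ⟩
            oddIndicator a * coshSum t ∎

theorem6p2 : ∀ {c ℓ} (F : CharZeroField c ℓ) (fE : List ℕ → FCarrier F) →
    IsShuffleCharacter F fE → Nonsingular F fE →
    (g : List ℕ → FCarrier F) → InvertsX F fE g →
    (α : List ℕ) → IsComp α → ¬ (α ≡ []) → isEven (sum α) ≡ false →
    CharZeroField._≈_ F (g α) (gFormula F α)
theorem6p2 F fE sc _ g invX α comp _ es =
  sinhRecursion-unique F g (gFormula F) (sinhRecursion F fE g sc invX) (gFormula-sinhRecursion F)
    (suc (length α)) α comp ℕP.≤-refl es
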